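{- Let $n$ be an even integer and $\alpha$ a permutation of $[n]$. Then $\Psi_{21}(\alpha)=\sum_{\pi}X_{(\mathbf g_\alpha)_{\downarrow\pi}}(\mathbf x^2),$ where the sum is over all perfect matchings $\pi$ of the graph $\mathbf g_\alpha$.
   Context: For a composition $a=(a_1,\dots,a_\ell)$ of $n$, let $c_a(\alpha)$ be the number of ordered set partitions $(A_1,\dots,A_\ell)$ of $[n]$ with $|A_i|=a_i$ such that for each $i$, $a_i$ is even and $st(\alpha|_{A_i})=2\,1\,4\,3\cdots a_i\,(a_i-1)$; here $\alpha|_{A}$ is the subword of the one-line word $\alpha(1)\cdots\alpha(n)$ consisting of the letters in $A$, and $st$ replaces the letters by $1,2,\dots$ preserving relative order. Define $\Psi_{21}(\alpha)=\sum_{a\models n}c_a(\alpha)M_a$, where $M_a=\sum_{i_1<\dots<i_\ell}x_{i_1}^{a_1}\cdots x_{i_\ell}^{a_\ell}$. The graph $\mathbf g_\alpha$ has vertex set $[n]$ and an edge $\{i,j\}$ ($i<j$) iff $\alpha(i)>\alpha(j)$ (it is the incomparability graph of the poset on $[n]$ with $i<j$ iff $i<j$ and $\alpha(i)<\alpha(j)$). For a graph $\mathbf g$ and a perfect matching $\pi$ of $\mathbf g$, $\mathbf g_{\downarrow\pi}$ is the simple graph obtained by contracting the edges of $\pi$: its vertices are the edges of $\pi$, two being adjacent iff some edge of $\mathbf g$ joins them. $X_{\mathbf h}$ denotes the chromatic symmetric function $\sum_\kappa\prod_v x_{\kappa(v)}$ over proper colorings $\kappa$ of $\mathbf h$ with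 positive integers, and $F(\mathbf x^2)$ denotes $F$ with each variable $x_i$ replaced by $x_i^2$. -}

module Defs where

open import Data.Bool using (Bool; true; false; _∧_; _∨_; not; if_then_else_)
open import Data.Nat using (ℕ; zero; suc; _+_; _*_; _<ᵇ_; _≡ᵇ_; _%_; _/_)
open import Data.Fin using (Fin; zero; suc; toℕ; _<?_)
open import Data.Fin.Properties using (_≟_)
open import Data.List using (List; []; _∷_; [_]; _++_; map; concatMap; filterᵇ; length; upTo; allFin)
open import Data.Bool.ListAction using (all; any)
open import Data.Nat.ListAction using (sum)
open import Data.List.Properties using (≡-dec)
import Data.Nat.Properties as ℕP
open import Data.Fin.Permutation using (Permutation′; _⟨$⟩ʳ_)
open import Relation.Nullary.Decidable using (⌊_⌋)
open import Relation.Binary.PropositionalEquality using (_≡_)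

funs : (m k : ℕ) → List (Fin m → Fin k)
funs zero    k = [ (λ ()) ]
funs (suc m) k =
  concatMap (λ c → map (λ f → λ { zero → c ; (suc i) → f i }) (funs m k)) (allFin k)

countᵇ : {A : Set} → (A → Bool) → List A → ℕ
countᵇ p xs = length (filterᵇ p xs)

_==_ : {n : ℕ} → Fin n → Fin n → Bool
i == j = ⌊ i ≟ j ⌋

_<F_ : {n : ℕ} → Fin n → Fin n → Bool
i <F j = ⌊ i <? j ⌋

_=L_ : List ℕ → List ℕ → Bool
xs =L ys = ⌊ ≡-dec ℕP._≟_ xs ys ⌋

-- Formal power series in x_1, x_2, … with ℕ coefficients.
-- A series F is given by its coefficients: F k β is the coefficient of
-- the monomial x_1^{β 0} ⋯ x_k^{β (k-1)} (every monomial arises this way).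

Series : Set
Series = (k : ℕ) → (Fin k → ℕ) → ℕ

_≈S_ : Series → Series → Set
F ≈S G = ∀ k (β : Fin k → ℕ) → F k β ≡ G k β

0S : Series
0S k β = 0

_+S_ : Series → Series → Series
(F +S G) k β = F k β + G k β

_·S_ : ℕ → Series → Series
(c ·S F) k β = c * F k β

ΣS : List Series → Series
ΣS []       = 0S
ΣS (F ∷ Fs) = F +S ΣS Fs

-- F(x^2): substitute x_i ↦ x_i^2
sq : Series → Series
sq F k β = if all (λ j → β j % 2 ≡ᵇ 0) (allFin k) then F k (λ j → β j / 2) else 0

expo : {ℓ k : ℕ} → (Fin ℓ → Fin k) → (Fin ℓ → ℕ) → Fin k → ℕ
expo {ℓ} ι a j = sum (map (λ t → if ι t == j then a t else 0) (allFin ℓ))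

strictlyIncr : {ℓ k : ℕ} → (Fin ℓ → Fin k) → Bool
strictlyIncr {ℓ} ι = all (λ s → all (λ t → not (s <F t) ∨ (ι s <F ι t)) (allFin ℓ)) (allFin ℓ)

M : {ℓ : ℕ} → (Fin ℓ → ℕ) → Series
M {ℓ} a k β = countᵇ (λ ι → strictlyIncr ι ∧ all (λ j → expo ι a j ≡ᵇ β j) (allFin k)) (funs ℓ k)

-- Compositions of n: (ℓ, a) with a t ≥ 1 and Σ a t = n.
-- (Every part is ≤ n and ℓ ≤ n, so enumerating a : Fin ℓ → Fin (suc n) suffices.)

record Composition (n : ℕ) : Set where
  constructor comp
  field
    len   : ℕ
    parts : Fin len → ℕ

compositions : (n : ℕ) → List (Composition n)
compositions n =
  concatMap (λ ℓ →
    map (λ a → comp ℓ (λ t → toℕ (a t)))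
      (filterᵇ (λ a → all (λ t → 0 <ᵇ toℕ (a t)) (allFin ℓ)
                      ∧ (sum (map (λ t → toℕ (a t)) (allFin ℓ)) ≡ᵇ n))
        (funs ℓ (suc n))))
    (upTo (suc n))

val : {n : ℕ} → Permutation′ n → Fin n → ℕ
val α i = toℕ (α ⟨$⟩ʳ i)

-- st: replace letters by 1,2,… preserving relative order (distinct letters)
st : List ℕ → List ℕ
st w = map (λ x → suc (countᵇ (λ y → y <ᵇ x) w)) w

pat21 : ℕ → List ℕ
pat21 zero    = []
pat21 (suc m) = pat21 m ++ (suc (suc (2 * m)) ∷ suc (2 * m) ∷ [])

restrict : {n ℓ : ℕ} → Permutation′ n → (Fin n → Fin ℓ) → Fin ℓ → List ℕ
restrict {n} α f i = map (val α) (filterᵇ (λ p → f p == i) (allFin n))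

-- c_a(α): ordered set partitions (A_0,…,A_{ℓ-1}) of [n] with |A_i| = a_i,
-- encoded as block-assignment maps f : Fin n → Fin ℓ (A_i = f⁻¹(i)).
c : {n : ℕ} → Composition n → Permutation′ n → ℕ
c {n} (comp ℓ a) α =
  countᵇ (λ f → all (λ i → (countᵇ (λ p → f p == i) (allFin n) ≡ᵇ a i)
                          ∧ (a i % 2 ≡ᵇ 0)
                          ∧ (st (restrict α f i) =L pat21 (a i / 2)))
                     (allFin ℓ))
         (funs n ℓ)

Ψ21 : {n : ℕ} → Permutation′ n → Series
Ψ21 {n} α = ΣS (map (λ a → c a α ·S M (Composition.parts a)) (compositions n))

Graph : ℕ → Set
Graph N = Fin N → Fin N → Bool

gα : {n : ℕ} → Permutation′ n → Graph n
gα α i j = ((i <F j) ∧ (val α j <ᵇ val α i)) ∨ ((j <F i) ∧ (val α i <ᵇ val α j))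

-- Perfect matchings of g, encoded as partner maps μ: a fixed-point-free
-- involution with every pair {v, μ v} an edge of g (edges of π = {{v, μ v}}).
isPerfectMatching : {N : ℕ} → Graph N → (Fin N → Fin N) → Bool
isPerfectMatching {N} g μ =
  all (λ v → not (μ v == v) ∧ (μ (μ v) == v) ∧ g v (μ v)) (allFin N)

perfectMatchings : {N : ℕ} → Graph N → List (Fin N → Fin N)
perfectMatchings {N} g = filterᵇ (isPerfectMatching g) (funs N N)

-- the edges of π, each represented by its smaller endpoint v (v < μ v)
matchEdges : {N : ℕ} → (Fin N → Fin N) → List (Fin N)
matchEdges {N} μ = filterᵇ (λ v → v <F μ v) (allFin N)

lookupL : {A : Set} → (xs : List A) → Fin (length xs) → A
lookupL (x ∷ xs) zero    = x
lookupL (x ∷ xs) (suc i) = lookupL xs i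

-- g_{↓π}: vertices are the edges of π (indexed by Fin (#edges)),
-- two distinct ones adjacent iff some edge of g joins them.
contract : {N : ℕ} → Graph N → (μ : Fin N → Fin N) → Graph (length (matchEdges μ))
contract g μ e e′ =
  not (e == e′) ∧
  any (λ u → any (λ w → g u w) (x′ ∷ μ x′ ∷ [])) (x ∷ μ x ∷ [])
  where
  x  = lookupL (matchEdges μ) e
  x′ = lookupL (matchEdges μ) e′

-- chromatic symmetric function X_g = Σ_{proper κ} ∏_v x_{κ v};
-- coefficient of x^β (β supported on the first k variables) counts proper
-- colourings κ : V → Fin k with |κ⁻¹(j)| = β j.
X : {N : ℕ} → Graph N → Series
X {N} g k β =
  countᵇ (λ κ → all (λ u → all (λ v → not (g u v) ∨ not (κ u == κ v)) (allFin N)) (allFin N)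
              ∧ all (λ j → countᵇ (λ v → κ v == j) (allFin N) ≡ᵇ β j) (allFin k))
         (funs N k)

-- Both sides count the matching colourings of g_α of type β: colourings κ of the positions with
-- |κ⁻¹(j)| = β j in which every position has exactly one g_α-neighbour of its own colour.
--
-- On the right, a perfect matching π together with a proper colouring of g_α↓π of type β/2 lifts to
-- such a κ by giving both endpoints of each edge the colour of the edge; conversely κ determines π
-- (v is matched to its unique same-coloured neighbour) and the colouring of the edges.
--
-- On the left, the coefficient of x^β counts triples (a, ordered set partition, monomial of M_a);
-- composing the block map with the increasing index map of the monomial is a colouring of type β.
-- A block standardises to 2 1 4 3 ⋯ exactly when it splits into consecutive descents, each above
-- all earlier letters, which happens exactly when every position of the block forms an inversion
-- with exactly one other position of the block, i.e. is g_α-adjacent to exactly one block mate.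

module Submission where

open import Defs
open import Data.Bool using (Bool; true; false; _∧_; _∨_; not; if_then_else_; T)
open import Data.Bool.Properties using (∨-comm)
open import Data.Bool.ListAction using (all; any)
open import Data.Empty using (⊥; ⊥-elim)
open import Data.Fin using (Fin; zero; suc; toℕ; _<?_; fromℕ<)
open import Data.Fin.Permutation using (Permutation′; _⟨$⟩ˡ_; inverseˡ)
open import Data.Fin.Properties using (_≟_; suc-injective; toℕ-injective; toℕ-fromℕ<)
open import Data.List using (List; []; _∷_; _++_; map; concatMap; filterᵇ; length; upTo; allFin; tabulate; applyUpTo)
open import Data.List.Membership.Propositional using (_∈_)
open import Data.List.Membership.Propositional.Properties using (∈-allFin; ∈-++⁻; ∈-++⁺ˡ; ∈-++⁺ʳ)
open import Data.List.Properties using (map-++; length-map; length-++; ≡-dec; ∷-injective; ∷-injectiveˡ; ∷-injectiveʳ; map-cong-local)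
open import Data.List.Relation.Unary.All using (All; []; _∷_)
import Data.List.Relation.Unary.All as AllM
import Data.List.Relation.Unary.All.Properties as AllP
open import Data.List.Relation.Unary.AllPairs using (AllPairs; []; _∷_)
import Data.List.Relation.Unary.AllPairs.Properties as APP
open import Data.List.Relation.Unary.Any using (here; there)
open import Data.Nat using (ℕ; zero; suc; _+_; _*_; _<ᵇ_; _≡ᵇ_; _%_; _/_; _≤_; _<_; z≤n; s≤s)
open import Data.Nat.Divisibility using (_∣_)
open import Data.Nat.DivMod using (m≡m%n+[m/n]*n; m*n%n≡0; m*n/n≡m)
open import Data.Nat.ListAction using (sum)
open import Data.Nat.Properties hiding (_≟_; _<?_) renaming (suc-injective to ℕ-suc-injective)
open import Data.Nat.Properties using () renaming (_≟_ to _≟ℕ_)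
open import Algebra.Properties.CommutativeSemigroup +-commutativeSemigroup using () renaming (interchange to +-interchange)
open import Data.Product using (Σ; _,_; proj₁; proj₂; _×_)
open import Data.Sum using (_⊎_; inj₁; inj₂; [_,_]′)
open import Function using (_∘_)
open import Relation.Binary using (tri<; tri≈; tri>)
open import Relation.Binary.PropositionalEquality
open import Relation.Nullary using (yes; no; ¬_)

true≢false : true ≢ false
true≢false ()

∧-elimˡ : ∀ {a b} → a ∧ b ≡ true → a ≡ true
∧-elimˡ {true} e = refl

∧-elimʳ : ∀ {a b} → a ∧ b ≡ true → b ≡ true
∧-elimʳ {true} e = e

∧-intro : ∀ {a b} → a ≡ true → b ≡ true → a ∧ b ≡ true
∧-intro refl refl = refl

∨-introʳ : ∀ {a b} → b ≡ true → a ∨ b ≡ true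
∨-introʳ {true} e = refl
∨-introʳ {false} e = e

false⇒not-true : {a : Bool} → a ≡ false → not a ≡ true
false⇒not-true refl = refl

¬true⇒false : {a : Bool} → ¬ (a ≡ true) → a ≡ false
¬true⇒false {true} h = ⊥-elim (h refl)
¬true⇒false {false} h = refl

bool-ext : {a b : Bool} → (a ≡ true → b ≡ true) → (b ≡ true → a ≡ true) → a ≡ b
bool-ext {true} {true} f g = refl
bool-ext {true} {false} f g = sym (f refl)
bool-ext {false} {true} f g = g refl
bool-ext {false} {false} f g = refl

≡ᵇ-true⇒≡ : ∀ {a b} → (a ≡ᵇ b) ≡ true → a ≡ b
≡ᵇ-true⇒≡ {a} {b} e = ≡ᵇ⇒≡ a b (subst T (sym e) _)

≡⇒≡ᵇ-true : ∀ {a b} → a ≡ b → (a ≡ᵇ b) ≡ true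
≡⇒≡ᵇ-true {a} {b} e with a ≡ᵇ b | ≡⇒≡ᵇ a b e
... | true | _ = refl

<⇒<ᵇ-true : ∀ {a b} → a < b → (a <ᵇ b) ≡ true
<⇒<ᵇ-true {a} {b} lt with a <ᵇ b | <⇒<ᵇ lt
... | true | _ = refl

<ᵇ-true⇒< : ∀ {a b} → (a <ᵇ b) ≡ true → a < b
<ᵇ-true⇒< {a} {b} e = <ᵇ⇒< a b (subst T (sym e) _)

≮⇒<ᵇ-false : ∀ {a b} → ¬ (a < b) → (a <ᵇ b) ≡ false
≮⇒<ᵇ-false nlt = ¬true⇒false (λ e → nlt (<ᵇ-true⇒< e))

==⇒≡ : ∀ {n} {i j : Fin n} → (i == j) ≡ true → i ≡ j
==⇒≡ {i = i} {j} e with i ≟ j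
... | yes p = p
==⇒≡ {i = i} {j} () | no _

==-refl : ∀ {n} (i : Fin n) → (i == i) ≡ true
==-refl i with i ≟ i
... | yes _ = refl
... | no ¬p = ⊥-elim (¬p refl)

≡⇒== : ∀ {n} {i j : Fin n} → i ≡ j → (i == j) ≡ true
≡⇒== refl = ==-refl _

≢⇒==false : ∀ {n} {i j : Fin n} → i ≢ j → (i == j) ≡ false
≢⇒==false ne = ¬true⇒false (λ e → ne (==⇒≡ e))

==-sym : ∀ {n} (i j : Fin n) → (i == j) ≡ (j == i)
==-sym i j = bool-ext (λ e → ≡⇒== (sym (==⇒≡ e))) (λ e → ≡⇒== (sym (==⇒≡ e)))

==-suc : ∀ {n} (i j : Fin n) → (suc i == suc j) ≡ (i == j)
==-suc i j = bool-ext (λ e → ≡⇒== (suc-injective (==⇒≡ e))) (λ e → ≡⇒== (cong suc (==⇒≡ e)))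

<F⇒< : ∀ {n} {i j : Fin n} → (i <F j) ≡ true → toℕ i < toℕ j
<F⇒< {i = i} {j} e with i <? j
... | yes p = p
<F⇒< {i = i} {j} () | no _

<⇒<F : ∀ {n} {i j : Fin n} → toℕ i < toℕ j → (i <F j) ≡ true
<⇒<F {i = i} {j} lt with i <? j
... | yes p = refl
... | no np = ⊥-elim (np lt)

≮⇒<F≡false : ∀ {n} {i j : Fin n} → ¬ (toℕ i < toℕ j) → (i <F j) ≡ false
≮⇒<F≡false nlt = ¬true⇒false (λ e → nlt (<F⇒< e))

⟦_⟧ : Bool → ℕ
⟦ true ⟧ = 1
⟦ false ⟧ = 0

∑ : {A : Set} → List A → (A → ℕ) → ℕ
∑ [] f = 0
∑ (x ∷ xs) f = f x + ∑ xs f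

⟦∧⟧ : ∀ a b → ⟦ a ∧ b ⟧ ≡ ⟦ a ⟧ * ⟦ b ⟧
⟦∧⟧ true b = sym (+-identityʳ ⟦ b ⟧)
⟦∧⟧ false b = refl

⟦⟧≤1 : ∀ a → ⟦ a ⟧ ≤ 1
⟦⟧≤1 true = s≤s z≤n
⟦⟧≤1 false = z≤n

⟦⟧-by-cases : ∀ (b : Bool) {x : ℕ} → (b ≡ true → x ≡ 1) → (b ≡ false → x ≡ 0) → x ≡ ⟦ b ⟧
⟦⟧-by-cases true t f = t refl
⟦⟧-by-cases false t f = f refl

¬true⇒⟦⟧≡0 : ∀ {b : Bool} → (b ≡ true → ⊥) → ⟦ b ⟧ ≡ 0
¬true⇒⟦⟧≡0 {true} h = ⊥-elim (h refl)
¬true⇒⟦⟧≡0 {false} h = refl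

module _ {A : Set} where
  ∑-cong : (xs : List A) {f g : A → ℕ} → (∀ x → f x ≡ g x) → ∑ xs f ≡ ∑ xs g
  ∑-cong [] e = refl
  ∑-cong (x ∷ xs) e = cong₂ _+_ (e x) (∑-cong xs e)

  ∑-zero : (xs : List A) (f : A → ℕ) → (∀ x → f x ≡ 0) → ∑ xs f ≡ 0
  ∑-zero [] f e = refl
  ∑-zero (x ∷ xs) f e rewrite e x = ∑-zero xs f e

  ∑-+ : (xs : List A) (f g : A → ℕ) → ∑ xs (λ x → f x + g x) ≡ ∑ xs f + ∑ xs g
  ∑-+ [] f g = refl
  ∑-+ (x ∷ xs) f g = trans (cong (f x + g x +_) (∑-+ xs f g)) (+-interchange (f x) (g x) (∑ xs f) (∑ xs g))

  ∑-*ˡ : (xs : List A) (c : ℕ) (f : A → ℕ) → ∑ xs (λ x → c * f x) ≡ c * ∑ xs f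
  ∑-*ˡ [] c f = sym (*-zeroʳ c)
  ∑-*ˡ (x ∷ xs) c f = trans (cong (c * f x +_) (∑-*ˡ xs c f)) (sym (*-distribˡ-+ c (f x) (∑ xs f)))

  ∑-*ʳ : (xs : List A) (c : ℕ) (f : A → ℕ) → ∑ xs (λ x → f x * c) ≡ ∑ xs f * c
  ∑-*ʳ xs c f = trans (∑-cong xs (λ x → *-comm (f x) c)) (trans (∑-*ˡ xs c f) (*-comm c _))

  ∑-mono-≤ : (xs : List A) (f g : A → ℕ) → (∀ x → f x ≤ g x) → ∑ xs f ≤ ∑ xs g
  ∑-mono-≤ [] f g e = z≤n
  ∑-mono-≤ (x ∷ xs) f g e = +-mono-≤ (e x) (∑-mono-≤ xs f g e)

  ∑-++ : (xs ys : List A) (f : A → ℕ) → ∑ (xs ++ ys) f ≡ ∑ xs f + ∑ ys f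
  ∑-++ [] ys f = refl
  ∑-++ (x ∷ xs) ys f = trans (cong (f x +_) (∑-++ xs ys f)) (sym (+-assoc (f x) _ _))

  ∑-filter : (xs : List A) (p : A → Bool) (f : A → ℕ) →
    ∑ (filterᵇ p xs) f ≡ ∑ xs (λ x → ⟦ p x ⟧ * f x)
  ∑-filter [] p f = refl
  ∑-filter (x ∷ xs) p f with p x
  ... | true = cong₂ _+_ (sym (+-identityʳ (f x))) (∑-filter xs p f)
  ... | false = ∑-filter xs p f

  countᵇ≡∑ : (p : A → Bool) (xs : List A) → countᵇ p xs ≡ ∑ xs (λ x → ⟦ p x ⟧)
  countᵇ≡∑ p [] = refl
  countᵇ≡∑ p (x ∷ xs) with p x
  ... | true = cong suc (countᵇ≡∑ p xs)
  ... | false = countᵇ≡∑ p xs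

  sum-map≡∑ : (f : A → ℕ) (xs : List A) → sum (map f xs) ≡ ∑ xs f
  sum-map≡∑ f [] = refl
  sum-map≡∑ f (x ∷ xs) = cong (f x +_) (sum-map≡∑ f xs)

module _ {A B : Set} where
  ∑-map : (h : A → B) (xs : List A) (f : B → ℕ) → ∑ (map h xs) f ≡ ∑ xs (λ x → f (h x))
  ∑-map h [] f = refl
  ∑-map h (x ∷ xs) f = cong (f (h x) +_) (∑-map h xs f)

  ∑-concatMap : (h : A → List B) (xs : List A) (f : B → ℕ) →
    ∑ (concatMap h xs) f ≡ ∑ xs (λ x → ∑ (h x) f)
  ∑-concatMap h [] f = refl
  ∑-concatMap h (x ∷ xs) f = trans (∑-++ (h x) (concatMap h xs) f) (cong (∑ (h x) f +_) (∑-concatMap h xs f))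

  ∑-swap : (xs : List A) (ys : List B) (F : A → B → ℕ) →
    ∑ xs (λ x → ∑ ys (λ y → F x y)) ≡ ∑ ys (λ y → ∑ xs (λ x → F x y))
  ∑-swap [] ys F = sym (∑-zero ys _ (λ _ → refl))
  ∑-swap (x ∷ xs) ys F = trans (cong (∑ ys (F x) +_) (∑-swap xs ys F)) (sym (∑-+ ys (F x) _))

  double-counting : (xs : List A) (ys : List B) (p : A → Bool) (q : B → Bool) (R : A → B → Bool) →
    (∀ x → p x ≡ true → ∑ ys (λ y → ⟦ R x y ⟧) ≡ 1) →
    (∀ y → q y ≡ true → ∑ xs (λ x → ⟦ p x ∧ R x y ⟧) ≡ 1) →
    (∀ x y → p x ≡ true → R x y ≡ true → q y ≡ true) →
    ∑ xs (λ x → ⟦ p x ⟧) ≡ ∑ ys (λ y → ⟦ q y ⟧)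
  double-counting xs ys p q R image-unique preimage-unique R-into-q = begin
      ∑ xs (λ x → ⟦ p x ⟧)                       ≡⟨ ∑-cong xs row ⟩
      ∑ xs (λ x → ∑ ys (λ y → ⟦ p x ∧ R x y ⟧)) ≡⟨ ∑-swap xs ys _ ⟩
      ∑ ys (λ y → ∑ xs (λ x → ⟦ p x ∧ R x y ⟧)) ≡⟨ ∑-cong ys column ⟩
      ∑ ys (λ y → ⟦ q y ⟧)                       ∎
    where
    open ≡-Reasoning
    row : ∀ x → ⟦ p x ⟧ ≡ ∑ ys (λ y → ⟦ p x ∧ R x y ⟧)
    row x with p x in px
    ... | true = sym (image-unique x px)
    ... | false = sym (∑-zero ys _ (λ _ → refl))
    column : ∀ y → ∑ xs (λ x → ⟦ p x ∧ R x y ⟧) ≡ ⟦ q y ⟧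
    column y with q y in qy
    ... | true = preimage-unique y qy
    ... | false = ∑-zero xs _ (λ x → ¬true⇒⟦⟧≡0 (λ h →
                    true≢false (trans (sym (R-into-q x y (∧-elimˡ h) (∧-elimʳ {p x} h))) qy)))

module _ {A : Set} where
  ∑-cong-∈ : (xs : List A) {f g : A → ℕ} → (∀ x → x ∈ xs → f x ≡ g x) → ∑ xs f ≡ ∑ xs g
  ∑-cong-∈ [] e = refl
  ∑-cong-∈ (x ∷ xs) e = cong₂ _+_ (e x (here refl)) (∑-cong-∈ xs (λ z m → e z (there m)))

  ∑-zero-∈ : (xs : List A) (f : A → ℕ) → (∀ x → x ∈ xs → f x ≡ 0) → ∑ xs f ≡ 0
  ∑-zero-∈ xs f e = trans (∑-cong-∈ xs e) (∑-zero xs (λ _ → 0) (λ _ → refl))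

  ∑≢0⇒∃ : (xs : List A) (p : A → Bool) → ∑ xs (λ z → ⟦ p z ⟧) ≢ 0 → Σ A λ z → z ∈ xs × p z ≡ true
  ∑≢0⇒∃ [] p ne = ⊥-elim (ne refl)
  ∑≢0⇒∃ (x ∷ xs) p ne with p x in px
  ... | true = x , here refl , px
  ... | false with ∑≢0⇒∃ xs p ne
  ...   | z , m , pz = z , there m , pz

  ∑-*≢0⇒∃ : (xs : List A) (p : A → Bool) (h : A → ℕ) → ∑ xs (λ t → ⟦ p t ⟧ * h t) ≢ 0 → Σ A λ t → p t ≡ true
  ∑-*≢0⇒∃ [] p h ne = ⊥-elim (ne refl)
  ∑-*≢0⇒∃ (x ∷ xs) p h ne with p x in px
  ... | true = x , px
  ... | false = ∑-*≢0⇒∃ xs p h ne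

  ∑≡0⇒∀ : (xs : List A) (p : A → Bool) → ∑ xs (λ z → ⟦ p z ⟧) ≡ 0 → ∀ z → z ∈ xs → p z ≡ false
  ∑≡0⇒∀ (x ∷ xs) p e z (here refl) with p x
  ... | false = refl
  ∑≡0⇒∀ (x ∷ xs) p e z (there m) with p x
  ... | false = ∑≡0⇒∀ xs p e z m

  countᵇ-++ : (p : A → Bool) (xs ys : List A) → countᵇ p (xs ++ ys) ≡ countᵇ p xs + countᵇ p ys
  countᵇ-++ p xs ys = trans (countᵇ≡∑ p (xs ++ ys)) (trans (∑-++ xs ys _) (sym (cong₂ _+_ (countᵇ≡∑ p xs) (countᵇ≡∑ p ys))))

  countᵇ≤length : (p : A → Bool) (xs : List A) → countᵇ p xs ≤ length xs
  countᵇ≤length p [] = z≤n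
  countᵇ≤length p (x ∷ xs) with p x
  ... | true = s≤s (countᵇ≤length p xs)
  ... | false = m≤n⇒m≤1+n (countᵇ≤length p xs)

  countᵇ≡length⇒All : (p : A → Bool) (xs : List A) → countᵇ p xs ≡ length xs → All (λ z → p z ≡ true) xs
  countᵇ≡length⇒All p [] e = []
  countᵇ≡length⇒All p (x ∷ xs) e with p x in px
  ... | true = px ∷ countᵇ≡length⇒All p xs (ℕ-suc-injective e)
  ... | false = ⊥-elim (<-irrefl e (s≤s (countᵇ≤length p xs)))

  All⇒countᵇ≡length : (p : A → Bool) (xs : List A) → All (λ z → p z ≡ true) xs → countᵇ p xs ≡ length xs
  All⇒countᵇ≡length p [] [] = refl
  All⇒countᵇ≡length p (x ∷ xs) (px ∷ ps) rewrite px = cong suc (All⇒countᵇ≡length p xs ps)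

  all-cong : (xs : List A) {p q : A → Bool} → (∀ x → p x ≡ q x) → all p xs ≡ all q xs
  all-cong [] e = refl
  all-cong (x ∷ xs) e = cong₂ _∧_ (e x) (all-cong xs e)

∑-product : {X Y : Set} (a : Bool) (xs : List X) (ys : List Y) (p : X → Bool) (q : Y → Bool) →
  ⟦ a ⟧ * (∑ xs (λ x → ⟦ p x ⟧) * ∑ ys (λ y → ⟦ q y ⟧)) ≡ ∑ xs (λ x → ∑ ys (λ y → ⟦ a ∧ (p x ∧ q y) ⟧))
∑-product a xs ys p q = begin
    ⟦ a ⟧ * (∑ xs (λ x → ⟦ p x ⟧) * ∑ ys (λ y → ⟦ q y ⟧))
      ≡⟨ cong (⟦ a ⟧ *_) (sym (∑-*ʳ xs _ _)) ⟩
    ⟦ a ⟧ * ∑ xs (λ x → ⟦ p x ⟧ * ∑ ys (λ y → ⟦ q y ⟧))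
      ≡⟨ sym (∑-*ˡ xs ⟦ a ⟧ _) ⟩
    ∑ xs (λ x → ⟦ a ⟧ * (⟦ p x ⟧ * ∑ ys (λ y → ⟦ q y ⟧)))
      ≡⟨ ∑-cong xs (λ x → cong (⟦ a ⟧ *_) (sym (∑-*ˡ ys ⟦ p x ⟧ _))) ⟩
    ∑ xs (λ x → ⟦ a ⟧ * ∑ ys (λ y → ⟦ p x ⟧ * ⟦ q y ⟧))
      ≡⟨ ∑-cong xs (λ x → sym (∑-*ˡ ys ⟦ a ⟧ _)) ⟩
    ∑ xs (λ x → ∑ ys (λ y → ⟦ a ⟧ * (⟦ p x ⟧ * ⟦ q y ⟧)))
      ≡⟨ ∑-cong xs (λ x → ∑-cong ys (λ y → sym (trans (⟦∧⟧ a _) (cong (⟦ a ⟧ *_) (⟦∧⟧ (p x) (q y)))))) ⟩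
    ∑ xs (λ x → ∑ ys (λ y → ⟦ a ∧ (p x ∧ q y) ⟧)) ∎
  where open ≡-Reasoning

∑-tabulate : {A : Set} (n : ℕ) (h : Fin n → A) (f : A → ℕ) → ∑ (tabulate h) f ≡ ∑ (allFin n) (λ i → f (h i))
∑-tabulate zero h f = refl
∑-tabulate (suc n) h f = cong (f (h zero) +_) (trans (∑-tabulate n (λ i → h (suc i)) f) (sym (∑-tabulate n suc (λ i → f (h i)))))

all-tabulate : {A : Set} (n : ℕ) (h : Fin n → A) (p : A → Bool) → all p (tabulate h) ≡ all (λ i → p (h i)) (allFin n)
all-tabulate zero h p = refl
all-tabulate (suc n) h p = cong (p (h zero) ∧_) (trans (all-tabulate n (λ i → h (suc i)) p) (sym (all-tabulate n suc (λ i → p (h i)))))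

∑-allFin-suc : (n : ℕ) (f : Fin (suc n) → ℕ) → ∑ (allFin (suc n)) f ≡ f zero + ∑ (allFin n) (λ i → f (suc i))
∑-allFin-suc n f = cong (f zero +_) (∑-tabulate n suc f)

all-allFin-suc : (n : ℕ) (f : Fin (suc n) → Bool) → all f (allFin (suc n)) ≡ f zero ∧ all (λ i → f (suc i)) (allFin n)
all-allFin-suc n f = cong (f zero ∧_) (all-tabulate n suc f)

all-allFin⁻ : (n : ℕ) (p : Fin n → Bool) → all p (allFin n) ≡ true → ∀ i → p i ≡ true
all-allFin⁻ (suc n) p e zero rewrite all-allFin-suc n p = ∧-elimˡ e
all-allFin⁻ (suc n) p e (suc i) rewrite all-allFin-suc n p = all-allFin⁻ n (λ i → p (suc i)) (∧-elimʳ {p zero} e) i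

all-allFin⁺ : (n : ℕ) (p : Fin n → Bool) → (∀ i → p i ≡ true) → all p (allFin n) ≡ true
all-allFin⁺ zero p h = refl
all-allFin⁺ (suc n) p h rewrite all-allFin-suc n p = ∧-intro (h zero) (all-allFin⁺ n (λ i → p (suc i)) (λ i → h (suc i)))

∑-allFin-const-1 : ∀ n → ∑ (allFin n) (λ _ → 1) ≡ n
∑-allFin-const-1 zero = refl
∑-allFin-const-1 (suc n) = trans (∑-allFin-suc n (λ _ → 1)) (cong suc (∑-allFin-const-1 n))

∑-δ : (k : ℕ) (d : Fin k) (f : Fin k → ℕ) → ∑ (allFin k) (λ c → ⟦ c == d ⟧ * f c) ≡ f d
∑-δ (suc k) d f = trans (∑-allFin-suc k _) (split d)
  where
  split : ∀ d → ⟦ zero == d ⟧ * f zero + ∑ (allFin k) (λ c → ⟦ suc c == d ⟧ * f (suc c)) ≡ f d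
  split zero = trans (cong₂ _+_ (+-identityʳ (f zero)) rest≡0) (+-identityʳ (f zero))
    where
    rest≡0 : ∑ (allFin k) (λ c → ⟦ suc c == zero ⟧ * f (suc c)) ≡ 0
    rest≡0 = ∑-zero (allFin k) _ (λ c → cong (λ b → ⟦ b ⟧ * f (suc c)) (≢⇒==false {i = suc c} {zero} (λ ())))
  split (suc d) = cong₂ _+_ (cong (λ b → ⟦ b ⟧ * f zero) (≢⇒==false {i = zero} {suc d} (λ ())))
                    (trans (∑-cong (allFin k) (λ c → cong (λ b → ⟦ b ⟧ * f (suc c)) (==-suc c d)))
                           (∑-δ k d (λ c → f (suc c))))

∑-δ₁ : (k : ℕ) (d : Fin k) → ∑ (allFin k) (λ c → ⟦ c == d ⟧) ≡ 1
∑-δ₁ k d = trans (∑-cong (allFin k) (λ c → sym (*-identityʳ ⟦ c == d ⟧))) (∑-δ k d (λ _ → 1))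

∑-allFin-≥ : ∀ m (F : Fin m → ℕ) t → F t ≤ ∑ (allFin m) F
∑-allFin-≥ m F t = subst (_≤ ∑ (allFin m) F) (∑-δ m t F) (∑-mono-≤ (allFin m) _ _ pointwise)
  where
  pointwise : ∀ s → ⟦ s == t ⟧ * F s ≤ F s
  pointwise s with s == t
  ... | true = ≤-reflexive (+-identityʳ (F s))
  ... | false = z≤n

find-or-none : ∀ n (p : Fin n → Bool) → (Σ (Fin n) λ v → p v ≡ true) ⊎ (∀ v → p v ≡ false)
find-or-none zero p = inj₂ (λ ())
find-or-none (suc n) p with p zero in p0
... | true = inj₁ (zero , p0)
... | false with find-or-none n (λ i → p (suc i))
...   | inj₁ (v , q) = inj₁ (suc v , q)
...   | inj₂ h = inj₂ λ { zero → p0 ; (suc v) → h v }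

∑≡1⇒unique : ∀ n (p : Fin n → Bool) → ∑ (allFin n) (λ v → ⟦ p v ⟧) ≡ 1 →
  Σ (Fin n) λ w → ∀ v → p v ≡ (v == w)
∑≡1⇒unique n p sum≡1 with find-or-none n p
... | inj₂ none = ⊥-elim (0≢1+n (trans (sym (∑-zero (allFin n) _ (λ v → cong ⟦_⟧ (none v)))) sum≡1))
... | inj₁ (w , pw) = w , λ v → bool-ext (λ pv → ≡⇒== (only v pv)) (λ e → subst (λ z → p z ≡ true) (sym (==⇒≡ e)) pw)
  where
  -- A second witness v ≢ w would make the sum at least 2.
  only : ∀ v → p v ≡ true → v ≡ w
  only v pv with v ≟ w
  ... | yes v≡w = v≡w
  ... | no v≢w = ⊥-elim (<-irrefl (sym sum≡1) two≤)
    where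
    pointwise : ∀ x → ⟦ x == v ⟧ + ⟦ x == w ⟧ ≤ ⟦ p x ⟧
    pointwise x with x ≟ v | x ≟ w
    ... | yes refl | yes refl = ⊥-elim (v≢w refl)
    ... | yes refl | no _ rewrite pv = ≤-refl
    ... | no _ | yes refl rewrite pw = ≤-refl
    ... | no _ | no _ = z≤n
    two≤ : 2 ≤ ∑ (allFin n) (λ x → ⟦ p x ⟧)
    two≤ = subst (_≤ ∑ (allFin n) (λ x → ⟦ p x ⟧))
             (trans (∑-+ (allFin n) _ _) (cong₂ _+_ (∑-δ₁ n v) (∑-δ₁ n w)))
             (∑-mono-≤ (allFin n) _ _ pointwise)

unique⇒∑≡1 : ∀ n (p : Fin n → Bool) (w : Fin n) → (∀ v → p v ≡ (v == w)) → ∑ (allFin n) (λ v → ⟦ p v ⟧) ≡ 1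
unique⇒∑≡1 n p w h = trans (∑-cong (allFin n) (λ v → cong ⟦_⟧ (h v))) (∑-δ₁ n w)

∑-fibres : {n ℓ : ℕ} (f : Fin n → Fin ℓ) (h : Fin ℓ → ℕ) →
  ∑ (allFin n) (λ v → h (f v)) ≡ ∑ (allFin ℓ) (λ t → ∑ (allFin n) (λ v → ⟦ f v == t ⟧) * h t)
∑-fibres {n} {ℓ} f h = begin
    ∑ (allFin n) (λ v → h (f v))
      ≡⟨ ∑-cong (allFin n) (λ v → sym (trans (∑-cong (allFin ℓ) (λ t → cong (λ z → ⟦ z ⟧ * h t) (==-sym (f v) t))) (∑-δ ℓ (f v) h))) ⟩
    ∑ (allFin n) (λ v → ∑ (allFin ℓ) (λ t → ⟦ f v == t ⟧ * h t))
      ≡⟨ ∑-swap (allFin n) (allFin ℓ) _ ⟩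
    ∑ (allFin ℓ) (λ t → ∑ (allFin n) (λ v → ⟦ f v == t ⟧ * h t))
      ≡⟨ ∑-cong (allFin ℓ) (λ t → ∑-*ʳ (allFin n) (h t) _) ⟩
    ∑ (allFin ℓ) (λ t → ∑ (allFin n) (λ v → ⟦ f v == t ⟧) * h t) ∎
  where open ≡-Reasoning

∑-applyUpTo : ∀ m (h : ℕ → ℕ) (F : ℕ → ℕ) → ∑ (applyUpTo h m) F ≡ ∑ (allFin m) (λ i → F (h (toℕ i)))
∑-applyUpTo zero h F = refl
∑-applyUpTo (suc m) h F = trans (cong (F (h 0) +_) (∑-applyUpTo m (λ z → h (suc z)) F)) (sym (∑-allFin-suc m _))

∑-upTo-δ : ∀ m c → c < m → ∑ (upTo m) (λ ℓ → ⟦ ℓ ≡ᵇ c ⟧) ≡ 1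
∑-upTo-δ m c lt = trans (∑-applyUpTo m (λ z → z) _) (trans (∑-cong (allFin m) (λ i → cong ⟦_⟧ (at i))) (∑-δ₁ m (fromℕ< lt)))
  where
  at : ∀ i → (toℕ i ≡ᵇ c) ≡ (i == fromℕ< lt)
  at i = bool-ext (λ e → ≡⇒== (toℕ-injective (trans (≡ᵇ-true⇒≡ e) (sym (toℕ-fromℕ< lt)))))
                  (λ e → ≡⇒≡ᵇ-true (trans (cong toℕ (==⇒≡ e)) (toℕ-fromℕ< lt)))

_≗ᵇ_ : {m k : ℕ} → (Fin m → Fin k) → (Fin m → Fin k) → Bool
_≗ᵇ_ {m} f g = all (λ i → f i == g i) (allFin m)

≗ᵇ⇒≗ : {m k : ℕ} {f g : Fin m → Fin k} → (f ≗ᵇ g) ≡ true → ∀ i → f i ≡ g i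
≗ᵇ⇒≗ {m} e i = ==⇒≡ (all-allFin⁻ m _ e i)

≗⇒≗ᵇ : {m k : ℕ} {f g : Fin m → Fin k} → (∀ i → f i ≡ g i) → (f ≗ᵇ g) ≡ true
≗⇒≗ᵇ {m} h = all-allFin⁺ m _ (λ i → ≡⇒== (h i))

≗ᵇ-sym : {m k : ℕ} (f g : Fin m → Fin k) → (f ≗ᵇ g) ≡ (g ≗ᵇ f)
≗ᵇ-sym {m} f g = all-cong (allFin m) (λ i → ==-sym (f i) (g i))

∑-funs-≗ᵇ : (m k : ℕ) (g : Fin m → Fin k) → ∑ (funs m k) (λ f → ⟦ f ≗ᵇ g ⟧) ≡ 1
∑-funs-≗ᵇ zero k g = refl
∑-funs-≗ᵇ (suc m) k g = begin
    ∑ (funs (suc m) k) (λ f → ⟦ f ≗ᵇ g ⟧)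
      ≡⟨ ∑-concatMap _ (allFin k) _ ⟩
    ∑ (allFin k) (λ c → ∑ (map _ (funs m k)) (λ f → ⟦ f ≗ᵇ g ⟧))
      ≡⟨ ∑-cong (allFin k) (λ c → trans (∑-map _ (funs m k) _) (∑-cong (funs m k) (λ f → cong ⟦_⟧ (all-allFin-suc m _)))) ⟩
    ∑ (allFin k) (λ c → ∑ (funs m k) (λ f → ⟦ (c == g zero) ∧ (f ≗ᵇ (g ∘ suc)) ⟧))
      ≡⟨ ∑-cong (allFin k) (λ c → trans (∑-cong (funs m k) (λ f → ⟦∧⟧ (c == g zero) _)) (∑-*ˡ (funs m k) ⟦ c == g zero ⟧ _)) ⟩
    ∑ (allFin k) (λ c → ⟦ c == g zero ⟧ * ∑ (funs m k) (λ f → ⟦ f ≗ᵇ (g ∘ suc) ⟧))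
      ≡⟨ ∑-cong (allFin k) (λ c → cong (⟦ c == g zero ⟧ *_) (∑-funs-≗ᵇ m k (g ∘ suc))) ⟩
    ∑ (allFin k) (λ c → ⟦ c == g zero ⟧ * 1)
      ≡⟨ ∑-δ k (g zero) (λ _ → 1) ⟩
    1 ∎
  where open ≡-Reasoning

∑-funs-≗ᵇ′ : (m k : ℕ) (g : Fin m → Fin k) → ∑ (funs m k) (λ f → ⟦ g ≗ᵇ f ⟧) ≡ 1
∑-funs-≗ᵇ′ m k g = trans (∑-cong (funs m k) (λ f → cong ⟦_⟧ (≗ᵇ-sym g f))) (∑-funs-≗ᵇ m k g)

Sorted : ∀ {n} → List (Fin n) → Set
Sorted = AllPairs (λ a b → toℕ a < toℕ b)

allFin-sorted : ∀ n → Sorted (allFin n)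
allFin-sorted n = APP.tabulate⁺-< (λ lt → lt)

filterᵇ-sorted : ∀ {n} (P : Fin n → Bool) (ys : List (Fin n)) → Sorted ys → Sorted (filterᵇ P ys)
filterᵇ-sorted P [] s = []
filterᵇ-sorted P (y ∷ ys) (y<ys ∷ s) with P y
... | true = filter-above ys y<ys ∷ filterᵇ-sorted P ys s
  where
  filter-above : ∀ zs → All (λ b → toℕ y < toℕ b) zs → All (λ b → toℕ y < toℕ b) (filterᵇ P zs)
  filter-above [] [] = []
  filter-above (z ∷ zs) (q ∷ qs) with P z
  ... | true = q ∷ filter-above zs qs
  ... | false = filter-above zs qs
... | false = filterᵇ-sorted P ys s

module _ {A : Set} where
  lookupL-∈ : (xs : List A) (e : Fin (length xs)) → lookupL xs e ∈ xs
  lookupL-∈ (x ∷ xs) zero = here refl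
  lookupL-∈ (x ∷ xs) (suc e) = there (lookupL-∈ xs e)

  ∈⇒lookupL : (xs : List A) {x : A} → x ∈ xs → Σ (Fin (length xs)) λ e → lookupL xs e ≡ x
  ∈⇒lookupL (y ∷ xs) (here refl) = zero , refl
  ∈⇒lookupL (y ∷ xs) (there m) = let (e , p) = ∈⇒lookupL xs m in suc e , p

  ∈-filterᵇ⁻ : (P : A → Bool) (xs : List A) {x : A} → x ∈ filterᵇ P xs → P x ≡ true
  ∈-filterᵇ⁻ P (y ∷ xs) m with P y in py
  ∈-filterᵇ⁻ P (y ∷ xs) (here refl) | true = py
  ∈-filterᵇ⁻ P (y ∷ xs) (there m) | true = ∈-filterᵇ⁻ P xs m
  ... | false = ∈-filterᵇ⁻ P xs m

  ∈-filterᵇ⁺ : (P : A → Bool) (xs : List A) {x : A} → x ∈ xs → P x ≡ true → x ∈ filterᵇ P xs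
  ∈-filterᵇ⁺ P (y ∷ xs) (here refl) px rewrite px = here refl
  ∈-filterᵇ⁺ P (y ∷ xs) (there m) px with P y
  ... | true = there (∈-filterᵇ⁺ P xs m px)
  ... | false = ∈-filterᵇ⁺ P xs m px

lookupL-mono : ∀ {n} (xs : List (Fin n)) → Sorted xs → (e e′ : Fin (length xs)) →
  toℕ e < toℕ e′ → toℕ (lookupL xs e) < toℕ (lookupL xs e′)
lookupL-mono (x ∷ xs) (x<xs ∷ s) zero (suc e′) lt = AllM.lookup x<xs (lookupL-∈ xs e′)
lookupL-mono (x ∷ xs) (x<xs ∷ s) (suc e) (suc e′) (s≤s lt) = lookupL-mono xs s e e′ lt

Increasing : {ℓ k : ℕ} → (Fin ℓ → Fin k) → Set
Increasing {ℓ} ι = ∀ (s t : Fin ℓ) → toℕ s < toℕ t → toℕ (ι s) < toℕ (ι t)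

strictlyIncr⇒Increasing : {ℓ k : ℕ} (ι : Fin ℓ → Fin k) → strictlyIncr ι ≡ true → Increasing ι
strictlyIncr⇒Increasing {ℓ} ι h s t lt with all-allFin⁻ ℓ _ (all-allFin⁻ ℓ _ h s) t
... | q rewrite <⇒<F {i = s} {t} lt = <F⇒< q

Increasing⇒strictlyIncr : {ℓ k : ℕ} (ι : Fin ℓ → Fin k) → Increasing ι → strictlyIncr ι ≡ true
Increasing⇒strictlyIncr {ℓ} ι h = all-allFin⁺ ℓ _ (λ s → all-allFin⁺ ℓ _ (λ t → at s t))
  where
  at : ∀ s t → (not (s <F t) ∨ (ι s <F ι t)) ≡ true
  at s t with s <F t in s<t
  ... | false = refl
  ... | true = <⇒<F (h s t (<F⇒< s<t))

Increasing-reflects-< : {ℓ k : ℕ} (ι : Fin ℓ → Fin k) → Increasing ι → ∀ s t → toℕ (ι s) < toℕ (ι t) → toℕ s < toℕ t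
Increasing-reflects-< ι h s t lt with <-cmp (toℕ s) (toℕ t)
... | tri< s<t _ _ = s<t
... | tri≈ _ s≡t _ = ⊥-elim (<-irrefl (cong (λ z → toℕ (ι z)) (toℕ-injective s≡t)) lt)
... | tri> _ _ t<s = ⊥-elim (<-asym lt (h t s t<s))

Increasing⇒injective : {ℓ k : ℕ} (ι : Fin ℓ → Fin k) → Increasing ι → ∀ s t → ι s ≡ ι t → s ≡ t
Increasing⇒injective ι h s t e with <-cmp (toℕ s) (toℕ t)
... | tri< s<t _ _ = ⊥-elim (<-irrefl (cong toℕ e) (h s t s<t))
... | tri≈ _ s≡t _ = toℕ-injective s≡t
... | tri> _ _ t<s = ⊥-elim (<-irrefl (cong toℕ (sym e)) (h t s t<s))

injective⇒==-reflected : {ℓ k : ℕ} (ι : Fin ℓ → Fin k) → (∀ s t → ι s ≡ ι t → s ≡ t) → ∀ s t → (ι s == ι t) ≡ (s == t)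
injective⇒==-reflected ι h s t = bool-ext (λ e → ≡⇒== (h s t (==⇒≡ e))) (λ e → ≡⇒== (cong ι (==⇒≡ e)))

-- By induction on t: if ι t < ι′ t, then ι t = ι′ s for some s < t, where ι s = ι′ s already.
Increasing-same-image⇒≗ : {ℓ k : ℕ} (ι ι′ : Fin ℓ → Fin k) → Increasing ι → Increasing ι′ →
  (∀ t → Σ (Fin ℓ) λ s → ι t ≡ ι′ s) → (∀ s → Σ (Fin ℓ) λ t → ι′ s ≡ ι t) → ∀ t → ι t ≡ ι′ t
Increasing-same-image⇒≗ {ℓ} ι ι′ ι↑ ι′↑ ι⊆ι′ ι′⊆ι t = below (suc (toℕ t)) t ≤-refl
  where
  below : ∀ N t → toℕ t < N → ι t ≡ ι′ t
  below (suc N) t lt with <-cmp (toℕ (ι t)) (toℕ (ι′ t)) | ι⊆ι′ t | ι′⊆ι t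
  ... | tri≈ _ e _ | _ | _ = toℕ-injective e
  ... | tri< ιt<ι′t _ _ | s , ιt≡ι′s | _ =
    ⊥-elim (<-irrefl (cong toℕ (trans (below N s (≤-trans s<t (≤-pred lt))) (sym ιt≡ι′s))) (ι↑ s t s<t))
    where
    s<t : toℕ s < toℕ t
    s<t = Increasing-reflects-< ι′ ι′↑ s t (subst (λ z → toℕ z < toℕ (ι′ t)) ιt≡ι′s ιt<ι′t)
  ... | tri> _ _ ι′t<ιt | _ | s , ι′t≡ιs =
    ⊥-elim (<-irrefl (cong toℕ (trans (sym (below N s (≤-trans s<t (≤-pred lt)))) (sym ι′t≡ιs))) (ι′↑ s t s<t))
    where
    s<t : toℕ s < toℕ t
    s<t = Increasing-reflects-< ι ι↑ s t (subst (λ z → toℕ z < toℕ (ι t)) ι′t≡ιs ι′t<ιt)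

module Enumeration {n : ℕ} (P : Fin n → Bool) where
  elems : List (Fin n)
  elems = filterᵇ P (allFin n)

  elem : Fin (length elems) → Fin n
  elem = lookupL elems

  elem-satisfies : ∀ e → P (elem e) ≡ true
  elem-satisfies e = ∈-filterᵇ⁻ P (allFin n) (lookupL-∈ elems e)

  index : ∀ x → P x ≡ true → Σ (Fin (length elems)) λ e → elem e ≡ x
  index x px = ∈⇒lookupL elems (∈-filterᵇ⁺ P (allFin n) (∈-allFin x) px)

  elem-increasing : Increasing elem
  elem-increasing = lookupL-mono elems (filterᵇ-sorted P (allFin n) (allFin-sorted n))

  elem-injective : ∀ e e′ → elem e ≡ elem e′ → e ≡ e′
  elem-injective = Increasing⇒injective elem elem-increasing

-- Every vertex has exactly one neighbour of its own colour: the colour classes induce perfect matchings.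
isMatchingColouring : {n k : ℕ} → Graph n → (Fin n → Fin k) → Bool
isMatchingColouring {n} g κ = all (λ u → countᵇ (λ v → (κ v == κ u) ∧ g u v) (allFin n) ≡ᵇ 1) (allFin n)

hasType : {n k : ℕ} → (Fin n → Fin k) → (Fin k → ℕ) → Bool
hasType {n} {k} κ β = all (λ j → countᵇ (λ v → κ v == j) (allFin n) ≡ᵇ β j) (allFin k)

matchingColourings : {n : ℕ} → Graph n → (k : ℕ) → (Fin k → ℕ) → ℕ
matchingColourings {n} g k β = ∑ (funs n k) (λ κ → ⟦ isMatchingColouring g κ ∧ hasType κ β ⟧)

module _ {n k : ℕ} where
  isMatchingColouring⁻ : (g : Graph n) (κ : Fin n → Fin k) → isMatchingColouring g κ ≡ true →
    ∀ u → ∑ (allFin n) (λ v → ⟦ (κ v == κ u) ∧ g u v ⟧) ≡ 1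
  isMatchingColouring⁻ g κ h u = trans (sym (countᵇ≡∑ _ (allFin n))) (≡ᵇ-true⇒≡ (all-allFin⁻ n _ h u))

  isMatchingColouring⁺ : (g : Graph n) (κ : Fin n → Fin k) →
    (∀ u → ∑ (allFin n) (λ v → ⟦ (κ v == κ u) ∧ g u v ⟧) ≡ 1) → isMatchingColouring g κ ≡ true
  isMatchingColouring⁺ g κ h = all-allFin⁺ n _ (λ u → ≡⇒≡ᵇ-true (trans (countᵇ≡∑ _ (allFin n)) (h u)))

  hasType⁻ : (κ : Fin n → Fin k) (β : Fin k → ℕ) → hasType κ β ≡ true → ∀ j → ∑ (allFin n) (λ v → ⟦ κ v == j ⟧) ≡ β j
  hasType⁻ κ β h j = trans (sym (countᵇ≡∑ _ (allFin n))) (≡ᵇ-true⇒≡ (all-allFin⁻ k _ h j))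

  hasType⁺ : (κ : Fin n → Fin k) (β : Fin k → ℕ) → (∀ j → ∑ (allFin n) (λ v → ⟦ κ v == j ⟧) ≡ β j) → hasType κ β ≡ true
  hasType⁺ κ β h = all-allFin⁺ k _ (λ j → ≡⇒≡ᵇ-true (trans (countᵇ≡∑ _ (allFin n)) (h j)))

ΣS-coefficient : {A : Set} (F : A → Series) (xs : List A) (k : ℕ) (β : Fin k → ℕ) → ΣS (map F xs) k β ≡ ∑ xs (λ x → F x k β)
ΣS-coefficient F [] k β = refl
ΣS-coefficient F (x ∷ xs) k β = cong (F x k β +_) (ΣS-coefficient F xs k β)

≡2*⇒even : ∀ m c → m ≡ 2 * c → (m % 2 ≡ᵇ 0) ≡ true × m / 2 ≡ c
≡2*⇒even m c refl = ≡⇒≡ᵇ-true (trans (cong (_% 2) (*-comm 2 c)) (m*n%n≡0 c 2)) , trans (cong (_/ 2) (*-comm 2 c)) (m*n/n≡m c 2)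

even⇒2*half : ∀ m → (m % 2 ≡ᵇ 0) ≡ true → 2 * (m / 2) ≡ m
even⇒2*half m h = sym (trans (m≡m%n+[m/n]*n m 2) (trans (cong (_+ (m / 2) * 2) (≡ᵇ-true⇒≡ h)) (*-comm (m / 2) 2)))

any-pair⁻ : {A : Set} (f : A → Bool) (a b : A) → any f (a ∷ b ∷ []) ≡ true → Σ A λ z → ((z ≡ a) ⊎ (z ≡ b)) × f z ≡ true
any-pair⁻ f a b e with f a in fa
... | true = a , inj₁ refl , fa
... | false with f b in fb
...   | true = b , inj₂ refl , fb
any-pair⁻ f a b () | false | false

any-pair⁺ : {A : Set} (f : A → Bool) (a b z : A) → ((z ≡ a) ⊎ (z ≡ b)) → f z ≡ true → any f (a ∷ b ∷ []) ≡ true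
any-pair⁺ f a b z (inj₁ refl) fz rewrite fz = refl
any-pair⁺ f a b z (inj₂ refl) fz rewrite fz = ∨-introʳ {f a} refl

-- Perfect matchings and contraction

module PerfectMatching {n : ℕ} (g : Graph n) (g-irrefl : ∀ u → g u u ≡ false)
                       (μ : Fin n → Fin n) (μ-perfect : isPerfectMatching g μ ≡ true) where

  private
    at : ∀ v → (not (μ v == v) ∧ (μ (μ v) == v) ∧ g v (μ v)) ≡ true
    at = all-allFin⁻ n _ μ-perfect

  μ-fixpoint-free : ∀ v → μ v ≢ v
  μ-fixpoint-free v μv≡v = true≢false (trans (sym (∧-elimˡ (at v))) (cong not (≡⇒== μv≡v)))

  μ-involutive : ∀ v → μ (μ v) ≡ v
  μ-involutive v = ==⇒≡ (∧-elimˡ (∧-elimʳ {not (μ v == v)} (at v)))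

  μ-adjacent : ∀ v → g v (μ v) ≡ true
  μ-adjacent v = ∧-elimʳ {μ (μ v) == v} (∧-elimʳ {not (μ v == v)} (at v))

  -- An edge of the matching is indexed by its smaller endpoint, as in matchEdges.
  open Enumeration (λ v → v <F μ v) public
    using () renaming (elem to rep; elem-satisfies to rep<μrep; index to repIndex; elem-injective to rep-injective)

  E : ℕ
  E = length (matchEdges μ)

  lowEnd : Fin n → Fin n
  lowEnd v = if v <F μ v then v else μ v

  lowEnd-low : ∀ v → (lowEnd v <F μ (lowEnd v)) ≡ true
  lowEnd-low v with v <F μ v in v<μv
  ... | true = v<μv
  ... | false with <-cmp (toℕ v) (toℕ (μ v))
  ...   | tri< lt _ _ = ⊥-elim (true≢false (trans (sym (<⇒<F lt)) v<μv))
  ...   | tri≈ _ eq _ = ⊥-elim (μ-fixpoint-free v (sym (toℕ-injective eq)))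
  ...   | tri> _ _ gt = subst (λ z → (μ v <F z) ≡ true) (sym (μ-involutive v)) (<⇒<F gt)

  lowEnd-cases : ∀ v → (lowEnd v ≡ v) ⊎ (lowEnd v ≡ μ v)
  lowEnd-cases v with v <F μ v
  ... | true = inj₁ refl
  ... | false = inj₂ refl

  edgeOf : Fin n → Fin E
  edgeOf v = proj₁ (repIndex (lowEnd v) (lowEnd-low v))

  rep-edgeOf : ∀ v → rep (edgeOf v) ≡ lowEnd v
  rep-edgeOf v = proj₂ (repIndex (lowEnd v) (lowEnd-low v))

  Endpoint : Fin E → Fin n → Set
  Endpoint e v = (v ≡ rep e) ⊎ (v ≡ μ (rep e))

  endpoint-edgeOf : ∀ v → Endpoint (edgeOf v) v
  endpoint-edgeOf v with lowEnd-cases v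
  ... | inj₁ q = inj₁ (sym (trans (rep-edgeOf v) q))
  ... | inj₂ q = inj₂ (trans (sym (μ-involutive v)) (cong μ (sym (trans (rep-edgeOf v) q))))

  edgeOf-endpoint : ∀ e v → Endpoint e v → edgeOf v ≡ e
  edgeOf-endpoint e v (inj₁ refl) = rep-injective _ _ (trans (rep-edgeOf (rep e)) lowEnd-rep)
    where
    lowEnd-rep : lowEnd (rep e) ≡ rep e
    lowEnd-rep rewrite rep<μrep e = refl
  edgeOf-endpoint e v (inj₂ refl) = rep-injective _ _ (trans (rep-edgeOf (μ (rep e))) lowEnd-μrep)
    where
    lowEnd-μrep : lowEnd (μ (rep e)) ≡ rep e
    lowEnd-μrep with μ (rep e) <F μ (μ (rep e)) in lt
    ... | true = ⊥-elim (<-asym (<F⇒< (rep<μrep e)) (subst (λ z → toℕ (μ (rep e)) < toℕ z) (μ-involutive (rep e)) (<F⇒< lt)))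
    ... | false = μ-involutive (rep e)

  edgeOf-μ : ∀ v → edgeOf (μ v) ≡ edgeOf v
  edgeOf-μ v with endpoint-edgeOf v
  ... | inj₁ q = edgeOf-endpoint _ _ (inj₂ (cong μ q))
  ... | inj₂ q = edgeOf-endpoint _ _ (inj₁ (trans (cong μ q) (μ-involutive _)))

  same-edge : ∀ v w → edgeOf v ≡ edgeOf w → (w ≡ v) ⊎ (w ≡ μ v)
  same-edge v w eq = both (endpoint-edgeOf v) (subst (λ e → Endpoint e w) (sym eq) (endpoint-edgeOf w))
    where
    both : ∀ {e} → Endpoint e v → Endpoint e w → (w ≡ v) ⊎ (w ≡ μ v)
    both (inj₁ refl) (inj₁ refl) = inj₁ refl
    both (inj₁ refl) (inj₂ refl) = inj₂ refl
    both (inj₂ refl) (inj₁ refl) = inj₂ (sym (μ-involutive _))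
    both (inj₂ refl) (inj₂ refl) = inj₁ refl

  edge-size : ∀ e → ∑ (allFin n) (λ v → ⟦ edgeOf v == e ⟧) ≡ 2
  edge-size e = trans (∑-cong (allFin n) at-v) (trans (∑-+ (allFin n) _ _) (cong₂ _+_ (∑-δ₁ n (rep e)) (∑-δ₁ n (μ (rep e)))))
    where
    at-v : ∀ v → ⟦ edgeOf v == e ⟧ ≡ ⟦ v == rep e ⟧ + ⟦ v == μ (rep e) ⟧
    at-v v with v ≟ rep e | v ≟ μ (rep e)
    ... | yes p | yes q = ⊥-elim (μ-fixpoint-free (rep e) (trans (sym q) p))
    ... | yes p | no _ rewrite edgeOf-endpoint e v (inj₁ p) | ==-refl e = refl
    ... | no _ | yes q rewrite edgeOf-endpoint e v (inj₂ q) | ==-refl e = refl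
    ... | no p | no q = cong ⟦_⟧ (≢⇒==false λ eq → [ p , q ]′ (subst (λ z → Endpoint z v) eq (endpoint-edgeOf v)))

  ∑-edgeOf : (h : Fin E → ℕ) → ∑ (allFin n) (λ v → h (edgeOf v)) ≡ ∑ (allFin E) (λ e → 2 * h e)
  ∑-edgeOf h = trans (∑-fibres edgeOf h) (∑-cong (allFin E) (λ e → cong (_* h e) (edge-size e)))

  contract-adjacent⁺ : ∀ e e′ a b → e ≢ e′ → Endpoint e a → Endpoint e′ b → g a b ≡ true → contract g μ e e′ ≡ true
  contract-adjacent⁺ e e′ a b e≢e′ a∈e b∈e′ gab = ∧-intro (false⇒not-true (≢⇒==false e≢e′))
    (any-pair⁺ (λ u → any (g u) (rep e′ ∷ μ (rep e′) ∷ [])) (rep e) (μ (rep e)) a a∈e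
      (any-pair⁺ (g a) (rep e′) (μ (rep e′)) b b∈e′ gab))

  contract-adjacent⁻ : ∀ e e′ → contract g μ e e′ ≡ true →
    (e ≢ e′) × Σ (Fin n) λ a → Σ (Fin n) λ b → Endpoint e a × Endpoint e′ b × g a b ≡ true
  contract-adjacent⁻ e e′ c
    with any-pair⁻ (λ u → any (g u) (rep e′ ∷ μ (rep e′) ∷ [])) (rep e) (μ (rep e)) (∧-elimʳ {not (e == e′)} c)
  ... | a , a∈e , ga with any-pair⁻ (g a) (rep e′) (μ (rep e′)) ga
  ...   | b , b∈e′ , gab = e≢e′ , a , b , a∈e , b∈e′ , gab
    where
    e≢e′ : e ≢ e′
    e≢e′ eq = true≢false (trans (sym (∧-elimˡ {not (e == e′)} c)) (cong not (≡⇒== eq)))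

  isProper : {k : ℕ} → (Fin E → Fin k) → Bool
  isProper l = all (λ u → all (λ v → not (contract g μ u v) ∨ not (l u == l v)) (allFin E)) (allFin E)

  isProper⁻ : {k : ℕ} (l : Fin E → Fin k) → isProper l ≡ true → ∀ e e′ → contract g μ e e′ ≡ true → (l e == l e′) ≡ false
  isProper⁻ l proper e e′ c with all-allFin⁻ E _ (all-allFin⁻ E _ proper e) e′
  ... | q rewrite c with l e == l e′
  ...   | false = refl
  isProper⁻ l proper e e′ c | () | true

  isProper⁺ : {k : ℕ} (l : Fin E → Fin k) → (∀ e e′ → contract g μ e e′ ≡ true → l e ≢ l e′) → isProper l ≡ true
  isProper⁺ l h = all-allFin⁺ E _ (λ e → all-allFin⁺ E _ (λ e′ → at-pair e e′))
    where
    at-pair : ∀ e e′ → (not (contract g μ e e′) ∨ not (l e == l e′)) ≡ true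
    at-pair e e′ with contract g μ e e′ in c
    ... | false = refl
    ... | true = false⇒not-true (≢⇒==false (h e e′ c))

  lift-same-colour-neighbour : {k : ℕ} (l : Fin E → Fin k) → isProper l ≡ true → (κ : Fin n → Fin k) →
    (∀ v → κ v ≡ l (edgeOf v)) → ∀ u v → ((κ v == κ u) ∧ g u v) ≡ (v == μ u)
  lift-same-colour-neighbour l proper κ κ≡l∘edgeOf u v = bool-ext to from
    where
    to : ((κ v == κ u) ∧ g u v) ≡ true → (v == μ u) ≡ true
    to h with edgeOf u ≟ edgeOf v
    ... | yes eq with same-edge u v eq
    ...   | inj₁ refl = ⊥-elim (true≢false (trans (sym (∧-elimʳ {κ v == κ v} h)) (g-irrefl v)))
    ...   | inj₂ q = ≡⇒== q
    to h | no ne = ⊥-elim (true≢false (trans (sym same-l) (isProper⁻ l proper (edgeOf u) (edgeOf v)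
                     (contract-adjacent⁺ _ _ u v ne (endpoint-edgeOf u) (endpoint-edgeOf v) (∧-elimʳ {κ v == κ u} h)))))
      where
      same-l : (l (edgeOf u) == l (edgeOf v)) ≡ true
      same-l = ≡⇒== (trans (sym (κ≡l∘edgeOf u)) (trans (sym (==⇒≡ (∧-elimˡ h))) (κ≡l∘edgeOf v)))
    from : (v == μ u) ≡ true → ((κ v == κ u) ∧ g u v) ≡ true
    from h with ==⇒≡ h
    ... | refl = ∧-intro (≡⇒== (trans (κ≡l∘edgeOf (μ u)) (trans (cong l (edgeOf-μ u)) (sym (κ≡l∘edgeOf u))))) (μ-adjacent u)

  factorsThrough : {k : ℕ} → (Fin E → Fin k) → (Fin n → Fin k) → Bool
  factorsThrough l κ = all (λ e → (κ (rep e) == l e) ∧ (κ (μ (rep e)) == l e)) (allFin E)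

  factorsThrough⁻ : {k : ℕ} (l : Fin E → Fin k) (κ : Fin n → Fin k) → factorsThrough l κ ≡ true → ∀ v → κ v ≡ l (edgeOf v)
  factorsThrough⁻ l κ h v with all-allFin⁻ E _ h (edgeOf v) | endpoint-edgeOf v
  ... | q | inj₁ p = trans (cong κ p) (==⇒≡ (∧-elimˡ q))
  ... | q | inj₂ p = trans (cong κ p) (==⇒≡ (∧-elimʳ {κ (rep (edgeOf v)) == l (edgeOf v)} q))

  factorsThrough⁺ : {k : ℕ} (l : Fin E → Fin k) (κ : Fin n → Fin k) → (∀ v → κ v ≡ l (edgeOf v)) → factorsThrough l κ ≡ true
  factorsThrough⁺ l κ h = all-allFin⁺ E _ (λ e → ∧-intro
    (≡⇒== (trans (h (rep e)) (cong l (edgeOf-endpoint e (rep e) (inj₁ refl)))))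
    (≡⇒== (trans (h (μ (rep e))) (cong l (edgeOf-endpoint e (μ (rep e)) (inj₂ refl))))))

-- The right-hand side counts matching colourings

module ContractionSide {n : ℕ} (g : Graph n) (g-sym : ∀ u v → g u v ≡ g v u) (g-irrefl : ∀ u → g u u ≡ false)
                       (k : ℕ) (β : Fin k → ℕ) where

  allEven : Bool
  allEven = all (λ j → β j % 2 ≡ᵇ 0) (allFin k)

  half : Fin k → ℕ
  half j = β j / 2

  edgeCount : (Fin n → Fin n) → ℕ
  edgeCount μ = length (matchEdges μ)

  properOfHalfType : (μ : Fin n → Fin n) → (Fin (edgeCount μ) → Fin k) → Bool
  properOfHalfType μ l = all (λ u → all (λ v → not (contract g μ u v) ∨ not (l u == l v)) (allFin (edgeCount μ))) (allFin (edgeCount μ))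
                       ∧ all (λ j → countᵇ (λ v → l v == j) (allFin (edgeCount μ)) ≡ᵇ half j) (allFin k)

  ColouredMatching : Set
  ColouredMatching = Σ (Fin n → Fin n) (λ μ → Fin (edgeCount μ) → Fin k)

  colouredMatchings : List ColouredMatching
  colouredMatchings = concatMap (λ μ → map (λ l → (μ , l)) (funs (edgeCount μ) k)) (funs n n)

  valid : ColouredMatching → Bool
  valid (μ , l) = isPerfectMatching g μ ∧ (allEven ∧ properOfHalfType μ l)

  lifts : ColouredMatching → (Fin n → Fin k) → Bool
  lifts (μ , l) κ = all (λ e → (κ (lookupL (matchEdges μ) e) == l e) ∧ (κ (μ (lookupL (matchEdges μ) e)) == l e)) (allFin (edgeCount μ))

  ∑-colouredMatchings : (F : ColouredMatching → ℕ) →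
    ∑ colouredMatchings F ≡ ∑ (funs n n) (λ μ → ∑ (funs (edgeCount μ) k) (λ l → F (μ , l)))
  ∑-colouredMatchings F = trans (∑-concatMap _ (funs n n) F) (∑-cong (funs n n) (λ μ → ∑-map _ (funs (edgeCount μ) k) F))

  coefficient≡count : ΣS (map (λ μ → sq (X (contract g μ))) (perfectMatchings g)) k β ≡ ∑ colouredMatchings (λ x → ⟦ valid x ⟧)
  coefficient≡count = begin
      ΣS (map (λ μ → sq (X (contract g μ))) (perfectMatchings g)) k β
        ≡⟨ ΣS-coefficient _ (perfectMatchings g) k β ⟩
      ∑ (filterᵇ (isPerfectMatching g) (funs n n)) (λ μ → sq (X (contract g μ)) k β)
        ≡⟨ ∑-filter (funs n n) _ _ ⟩
      ∑ (funs n n) (λ μ → ⟦ isPerfectMatching g μ ⟧ * sq (X (contract g μ)) k β)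
        ≡⟨ ∑-cong (funs n n) term ⟩
      ∑ (funs n n) (λ μ → ∑ (funs (edgeCount μ) k) (λ l → ⟦ valid (μ , l) ⟧))
        ≡⟨ sym (∑-colouredMatchings _) ⟩
      ∑ colouredMatchings (λ x → ⟦ valid x ⟧) ∎
    where
    open ≡-Reasoning
    term : ∀ μ → ⟦ isPerfectMatching g μ ⟧ * sq (X (contract g μ)) k β ≡ ∑ (funs (edgeCount μ) k) (λ l → ⟦ valid (μ , l) ⟧)
    term μ with isPerfectMatching g μ
    ... | false = sym (∑-zero (funs (edgeCount μ) k) _ (λ _ → refl))
    ... | true with allEven
    ...   | false = sym (∑-zero (funs (edgeCount μ) k) _ (λ _ → refl))
    ...   | true = trans (+-identityʳ _) (countᵇ≡∑ _ (funs (edgeCount μ) k))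

  module _ (μ : Fin n → Fin n) (μ-perfect : isPerfectMatching g μ ≡ true) where
    open PerfectMatching g g-irrefl μ μ-perfect

    halfType⁻ : (l : Fin E → Fin k) → properOfHalfType μ l ≡ true → ∀ j → ∑ (allFin E) (λ e → ⟦ l e == j ⟧) ≡ half j
    halfType⁻ l h j = trans (sym (countᵇ≡∑ _ (allFin E))) (≡ᵇ-true⇒≡ (all-allFin⁻ k _ (∧-elimʳ {isProper l} h) j))

    lift-type : (l : Fin E → Fin k) (κ : Fin n → Fin k) → (∀ v → κ v ≡ l (edgeOf v)) →
      ∀ j → ∑ (allFin n) (λ v → ⟦ κ v == j ⟧) ≡ 2 * ∑ (allFin E) (λ e → ⟦ l e == j ⟧)
    lift-type l κ κ≡l∘edgeOf j = trans (∑-cong (allFin n) (λ v → cong (λ z → ⟦ z == j ⟧) (κ≡l∘edgeOf v)))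
                                   (trans (∑-edgeOf (λ e → ⟦ l e == j ⟧)) (∑-*ˡ (allFin E) 2 _))

    unique-lift : (l : Fin E → Fin k) → ∑ (funs n k) (λ κ → ⟦ lifts (μ , l) κ ⟧) ≡ 1
    unique-lift l = trans (∑-cong (funs n k) (λ κ → cong ⟦_⟧ (bool-ext
                      (λ r → ≗⇒≗ᵇ (λ v → sym (factorsThrough⁻ l κ r v)))
                      (λ e → factorsThrough⁺ l κ (λ v → sym (≗ᵇ⇒≗ e v))))))
                      (∑-funs-≗ᵇ′ n k (l ∘ edgeOf))

    lift-is-matching-colouring : (l : Fin E → Fin k) (κ : Fin n → Fin k) → allEven ≡ true →
      properOfHalfType μ l ≡ true → lifts (μ , l) κ ≡ true → (isMatchingColouring g κ ∧ hasType κ β) ≡ true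
    lift-is-matching-colouring l κ even proper lift = ∧-intro
      (isMatchingColouring⁺ g κ (λ u → unique⇒∑≡1 n _ (μ u) (lift-same-colour-neighbour l (∧-elimˡ proper) κ κ≡l∘edgeOf u)))
      (hasType⁺ κ β (λ j → trans (lift-type l κ κ≡l∘edgeOf j)
        (trans (cong (2 *_) (halfType⁻ l proper j)) (even⇒2*half (β j) (all-allFin⁻ k _ even j)))))
      where
      κ≡l∘edgeOf : ∀ v → κ v ≡ l (edgeOf v)
      κ≡l∘edgeOf = factorsThrough⁻ l κ lift

  module Preimage (κ : Fin n → Fin k) (κ-ok : (isMatchingColouring g κ ∧ hasType κ β) ≡ true) where
    private
      one-partner : ∀ u → ∑ (allFin n) (λ v → ⟦ (κ v == κ u) ∧ g u v ⟧) ≡ 1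
      one-partner = isMatchingColouring⁻ g κ (∧-elimˡ κ-ok)

    partner : Fin n → Fin n
    partner u = proj₁ (∑≡1⇒unique n _ (one-partner u))

    partner-spec : ∀ u v → ((κ v == κ u) ∧ g u v) ≡ (v == partner u)
    partner-spec u = proj₂ (∑≡1⇒unique n _ (one-partner u))

    partner-colour : ∀ u → κ (partner u) ≡ κ u
    partner-colour u = ==⇒≡ (∧-elimˡ (trans (partner-spec u (partner u)) (==-refl _)))

    partner-adjacent : ∀ u → g u (partner u) ≡ true
    partner-adjacent u = ∧-elimʳ {κ (partner u) == κ u} (trans (partner-spec u (partner u)) (==-refl _))

    partner-unique : ∀ u v → κ v ≡ κ u → g u v ≡ true → v ≡ partner u
    partner-unique u v same adj = ==⇒≡ (trans (sym (partner-spec u v)) (∧-intro (≡⇒== same) adj))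

    partner-perfect : (μ : Fin n → Fin n) → (∀ u → μ u ≡ partner u) → isPerfectMatching g μ ≡ true
    partner-perfect μ μ≗ = all-allFin⁺ n _ (λ v → ∧-intro (false⇒not-true (≢⇒==false (fixpoint-free v)))
                             (∧-intro (≡⇒== (involutive v)) (subst (λ z → g v z ≡ true) (sym (μ≗ v)) (partner-adjacent v))))
      where
      fixpoint-free : ∀ v → μ v ≢ v
      fixpoint-free v e = true≢false (trans (sym (partner-adjacent v)) (trans (cong (g v) (trans (sym (μ≗ v)) e)) (g-irrefl v)))
      involutive : ∀ v → μ (μ v) ≡ v
      involutive v = trans (cong μ (μ≗ v)) (trans (μ≗ (partner v))
                       (sym (partner-unique (partner v) v (sym (partner-colour v)) (trans (g-sym (partner v) v) (partner-adjacent v)))))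

    lifted-matching≗partner : ∀ μ l → (valid (μ , l) ∧ lifts (μ , l) κ) ≡ true → ∀ u → μ u ≡ partner u
    lifted-matching≗partner μ l h u =
      ==⇒≡ (trans (sym (partner-spec u (μ u))) (trans (lift-same-colour-neighbour l (∧-elimˡ proper) κ κ≡l∘edgeOf u (μ u)) (==-refl (μ u))))
      where
      μ-perfect : isPerfectMatching g μ ≡ true
      μ-perfect = ∧-elimˡ (∧-elimˡ h)
      open PerfectMatching g g-irrefl μ μ-perfect
      proper : properOfHalfType μ l ≡ true
      proper = ∧-elimʳ {allEven} (∧-elimʳ {isPerfectMatching g μ} (∧-elimˡ h))
      κ≡l∘edgeOf : ∀ v → κ v ≡ l (edgeOf v)
      κ≡l∘edgeOf = factorsThrough⁻ l κ (∧-elimʳ {valid (μ , l)} h)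

    module _ (μ : Fin n → Fin n) (μ≗ : ∀ u → μ u ≡ partner u) where
      μ-perfect : isPerfectMatching g μ ≡ true
      μ-perfect = partner-perfect μ μ≗
      open PerfectMatching g g-irrefl μ μ-perfect

      edgeColour : Fin E → Fin k
      edgeColour e = κ (rep e)

      κ≡edgeColour∘edgeOf : ∀ v → κ v ≡ edgeColour (edgeOf v)
      κ≡edgeColour∘edgeOf v = by-endpoint (endpoint-edgeOf v)
        where
        by-endpoint : Endpoint (edgeOf v) v → κ v ≡ edgeColour (edgeOf v)
        by-endpoint (inj₁ p) = cong κ p
        by-endpoint (inj₂ p) = trans (cong κ p) (trans (cong κ (μ≗ _)) (partner-colour _))

      edgeColour-proper : ∀ e e′ → contract g μ e e′ ≡ true → edgeColour e ≢ edgeColour e′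
      edgeColour-proper e e′ c same with contract-adjacent⁻ e e′ c
      ... | e≢e′ , a , b , a∈e , b∈e′ , gab = e≢e′ (trans (sym ea) (trans (sym (edgeOf-μ a)) (trans (cong edgeOf (sym b≡μa)) eb)))
        where
        ea : edgeOf a ≡ e
        ea = edgeOf-endpoint e a a∈e
        eb : edgeOf b ≡ e′
        eb = edgeOf-endpoint e′ b b∈e′
        κb≡κa : κ b ≡ κ a
        κb≡κa = trans (κ≡edgeColour∘edgeOf b) (trans (cong edgeColour eb) (trans (sym same)
                  (trans (cong edgeColour (sym ea)) (sym (κ≡edgeColour∘edgeOf a)))))
        b≡μa : b ≡ μ a
        b≡μa = trans (partner-unique a b κb≡κa gab) (sym (μ≗ a))

      colour-valid : ∀ l → (l ≗ᵇ edgeColour) ≡ true → (valid (μ , l) ∧ lifts (μ , l) κ) ≡ true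
      colour-valid l l≗ = ∧-intro (∧-intro μ-perfect (∧-intro even (∧-intro proper type)))
                                  (factorsThrough⁺ l κ κ≡l∘edgeOf)
        where
        κ≡l∘edgeOf : ∀ v → κ v ≡ l (edgeOf v)
        κ≡l∘edgeOf v = trans (κ≡edgeColour∘edgeOf v) (sym (≗ᵇ⇒≗ {f = l} l≗ _))
        halves : ∀ j → ((β j % 2 ≡ᵇ 0) ≡ true) × half j ≡ ∑ (allFin E) (λ e → ⟦ l e == j ⟧)
        halves j = ≡2*⇒even (β j) _ (trans (sym (hasType⁻ κ β (∧-elimʳ {isMatchingColouring g κ} κ-ok) j))
                                          (lift-type μ μ-perfect l κ κ≡l∘edgeOf j))
        even : allEven ≡ true
        even = all-allFin⁺ k _ (λ j → proj₁ (halves j))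
        proper : isProper l ≡ true
        proper = isProper⁺ l (λ e e′ c le≡le′ → edgeColour-proper e e′ c
                   (trans (sym (≗ᵇ⇒≗ {f = l} l≗ e)) (trans le≡le′ (≗ᵇ⇒≗ {f = l} l≗ e′))))
        type : all (λ j → countᵇ (λ v → l v == j) (allFin E) ≡ᵇ half j) (allFin k) ≡ true
        type = all-allFin⁺ k _ (λ j → ≡⇒≡ᵇ-true (trans (countᵇ≡∑ _ (allFin E)) (sym (proj₂ (halves j)))))

      colour-unique : ∑ (funs E k) (λ l → ⟦ valid (μ , l) ∧ lifts (μ , l) κ ⟧) ≡ 1
      colour-unique = trans (∑-cong (funs E k) (λ l → cong ⟦_⟧ (bool-ext (to l) (colour-valid l)))) (∑-funs-≗ᵇ E k edgeColour)
        where
        to : ∀ l → (valid (μ , l) ∧ lifts (μ , l) κ) ≡ true → (l ≗ᵇ edgeColour) ≡ true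
        to l h = ≗⇒≗ᵇ (λ e → sym (trans (factorsThrough⁻ l κ (∧-elimʳ {valid (μ , l)} h) (rep e))
                                        (cong l (edgeOf-endpoint e (rep e) (inj₁ refl)))))

    ∑-colours : ∀ μ → ∑ (funs (edgeCount μ) k) (λ l → ⟦ valid (μ , l) ∧ lifts (μ , l) κ ⟧) ≡ ⟦ μ ≗ᵇ partner ⟧
    ∑-colours μ = ⟦⟧-by-cases (μ ≗ᵇ partner) (λ q → colour-unique μ (≗ᵇ⇒≗ q))
                    (λ q → ∑-zero (funs (edgeCount μ) k) _
                       (λ l → ¬true⇒⟦⟧≡0 (λ h → true≢false (trans (sym (≗⇒≗ᵇ (lifted-matching≗partner μ l h))) q))))

  unique-preimage : ∀ κ → (isMatchingColouring g κ ∧ hasType κ β) ≡ true →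
    ∑ colouredMatchings (λ x → ⟦ valid x ∧ lifts x κ ⟧) ≡ 1
  unique-preimage κ κ-ok = trans (∑-colouredMatchings _)
    (trans (∑-cong (funs n n) (Preimage.∑-colours κ κ-ok)) (∑-funs-≗ᵇ n n (Preimage.partner κ κ-ok)))

  contraction-sum≡matchingColourings :
    ΣS (map (λ μ → sq (X (contract g μ))) (perfectMatchings g)) k β ≡ matchingColourings g k β
  contraction-sum≡matchingColourings = trans coefficient≡count
    (double-counting colouredMatchings (funs n k) valid (λ κ → isMatchingColouring g κ ∧ hasType κ β) lifts
      (λ { (μ , l) h → unique-lift μ (∧-elimˡ h) l })
      unique-preimage
      (λ { (μ , l) κ h → lift-is-matching-colouring μ (∧-elimˡ h) l κ
             (∧-elimˡ (∧-elimʳ {isPerfectMatching g μ} h)) (∧-elimʳ {allEven} (∧-elimʳ {isPerfectMatching g μ} h)) }))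


-- Standardisation and the pattern 2 1 4 3 ⋯

=L-true⇒≡ : ∀ {xs ys} → (xs =L ys) ≡ true → xs ≡ ys
=L-true⇒≡ {xs} {ys} e with ≡-dec _≟ℕ_ xs ys
... | yes p = p
=L-true⇒≡ {xs} {ys} () | no _

≡⇒=L-true : ∀ {xs ys} → xs ≡ ys → (xs =L ys) ≡ true
≡⇒=L-true {xs} {ys} e with ≡-dec _≟ℕ_ xs ys
... | yes p = refl
... | no np = ⊥-elim (np e)

module _ {A : Set} where
  ++-injective : (xs ys : List A) {zs ws : List A} → length xs ≡ length ys → xs ++ zs ≡ ys ++ ws → xs ≡ ys × zs ≡ ws
  ++-injective [] [] _ e = refl , e
  ++-injective (x ∷ xs) (y ∷ ys) l e with ∷-injective e
  ... | x≡y , rest with ++-injective xs ys (ℕ-suc-injective l) rest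
  ...   | xs≡ys , zs≡ws = cong₂ _∷_ x≡y xs≡ys , zs≡ws

  split-last-two : (S : List A) (m : ℕ) → length S ≡ suc (suc m) →
    Σ (List A) λ S′ → Σ A λ x → Σ A λ y → S ≡ S′ ++ x ∷ y ∷ [] × length S′ ≡ m
  split-last-two (a ∷ b ∷ []) zero refl = [] , a , b , refl , refl
  split-last-two (a ∷ b ∷ c ∷ S) (suc m) l with split-last-two (b ∷ c ∷ S) m (ℕ-suc-injective l)
  ... | S′ , x , y , eq , l′ = a ∷ S′ , x , y , cong (a ∷_) eq , cong suc l′

length-pat21 : ∀ m → length (pat21 m) ≡ 2 * m
length-pat21 zero = refl
length-pat21 (suc m) = trans (length-++ (pat21 m)) (trans (cong (_+ 2) (length-pat21 m)) (trans (+-comm (2 * m) 2) (sym (*-suc 2 m))))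

rank : List ℕ → ℕ → ℕ
rank w x = suc (countᵇ (λ y → y <ᵇ x) w)

rank-snoc : ∀ w a b z → rank (w ++ a ∷ b ∷ []) z ≡ suc (countᵇ (λ y → y <ᵇ z) w + (⟦ a <ᵇ z ⟧ + (⟦ b <ᵇ z ⟧ + 0)))
rank-snoc w a b z = cong suc (trans (countᵇ-++ _ w (a ∷ b ∷ [])) (cong (countᵇ (λ y → y <ᵇ z) w +_) (countᵇ≡∑ (λ y → y <ᵇ z) (a ∷ b ∷ []))))

st-snoc : ∀ w a b → st (w ++ a ∷ b ∷ []) ≡ map (rank (w ++ a ∷ b ∷ [])) w ++ rank (w ++ a ∷ b ∷ []) a ∷ rank (w ++ a ∷ b ∷ []) b ∷ []
st-snoc w a b = map-++ (rank (w ++ a ∷ b ∷ [])) w (a ∷ b ∷ [])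

module _ (w : List ℕ) (a b : ℕ) (b<a : b < a) (w<b : All (_< b) w) where
  rank-below : map (rank (w ++ a ∷ b ∷ [])) w ≡ st w
  rank-below = map-cong-local (AllM.map (λ {z} z<b → trans (rank-snoc w a b z) (cong suc (trans
                 (cong (countᵇ (λ y → y <ᵇ z) w +_) (cong₂ (λ p q → ⟦ p ⟧ + (⟦ q ⟧ + 0))
                    (≮⇒<ᵇ-false (λ a<z → <-asym a<z (<-trans z<b b<a))) (≮⇒<ᵇ-false (λ b<z → <-asym b<z z<b))))
                 (+-identityʳ _)))) w<b)

  rank-top : rank (w ++ a ∷ b ∷ []) a ≡ suc (suc (length w))
  rank-top = trans (rank-snoc w a b a) (cong suc (trans
    (cong₂ (λ p q → p + (⟦ q ⟧ + (⟦ b <ᵇ a ⟧ + 0)))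
      (All⇒countᵇ≡length (λ y → y <ᵇ a) w (AllM.map (λ z<b → <⇒<ᵇ-true (<-trans z<b b<a)) w<b))
      (≮⇒<ᵇ-false {a} {a} (<-irrefl refl)))
    (trans (cong (λ q → length w + (0 + (⟦ q ⟧ + 0))) (<⇒<ᵇ-true b<a)) (+-comm (length w) 1))))

  rank-second : rank (w ++ a ∷ b ∷ []) b ≡ suc (length w)
  rank-second = trans (rank-snoc w a b b) (cong suc (trans
    (cong₂ (λ p q → p + (⟦ q ⟧ + (⟦ b <ᵇ b ⟧ + 0)))
      (All⇒countᵇ≡length (λ y → y <ᵇ b) w (AllM.map <⇒<ᵇ-true w<b))
      (≮⇒<ᵇ-false (λ a<b → <-asym a<b b<a)))
    (trans (cong (λ q → length w + (0 + (⟦ q ⟧ + 0))) (≮⇒<ᵇ-false {b} {b} (<-irrefl refl))) (+-identityʳ _))))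

top-pair-from-ranks : ∀ w a b m → length w ≡ 2 * m →
  rank (w ++ a ∷ b ∷ []) a ≡ suc (suc (2 * m)) → rank (w ++ a ∷ b ∷ []) b ≡ suc (2 * m) →
  b < a × All (_< b) w
top-pair-from-ranks w a b m lw ra rb = b<a , w<b
  where
  below-a below-b : ℕ
  below-a = countᵇ (λ z → z <ᵇ a) w
  below-b = countᵇ (λ z → z <ᵇ b) w
  ra′ : below-a + (⟦ a <ᵇ a ⟧ + (⟦ b <ᵇ a ⟧ + 0)) ≡ suc (2 * m)
  ra′ = ℕ-suc-injective (trans (sym (rank-snoc w a b a)) ra)
  rb′ : below-b + (⟦ a <ᵇ b ⟧ + (⟦ b <ᵇ b ⟧ + 0)) ≡ 2 * m
  rb′ = ℕ-suc-injective (trans (sym (rank-snoc w a b b)) rb)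
  b<a : b < a
  b<a with b <ᵇ a in q
  ... | true = <ᵇ-true⇒< q
  ... | false = ⊥-elim (<-irrefl refl (subst (_≤ 2 * m) below-a≡ (subst (below-a ≤_) lw (countᵇ≤length _ w))))
    where
    below-a≡ : below-a ≡ suc (2 * m)
    below-a≡ = trans (sym (+-identityʳ below-a))
                 (trans (cong (below-a +_) (sym (cong₂ (λ p r → ⟦ p ⟧ + (⟦ r ⟧ + 0)) (≮⇒<ᵇ-false {a} {a} (<-irrefl refl)) q))) ra′)
  below-b≡ : below-b ≡ 2 * m
  below-b≡ = trans (sym (+-identityʳ below-b)) (trans (cong (below-b +_) (sym (cong₂ (λ p q → ⟦ p ⟧ + (⟦ q ⟧ + 0))
               (≮⇒<ᵇ-false {a} {b} (λ a<b → <-asym a<b b<a)) (≮⇒<ᵇ-false {b} {b} (<-irrefl refl))))) rb′)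
  w<b : All (_< b) w
  w<b = AllM.map <ᵇ-true⇒< (countᵇ≡length⇒All _ w (trans below-b≡ (sym lw)))

data StackedDescents {A : Set} (key : A → ℕ) : List A → Set where
  [] : StackedDescents key []
  snoc : ∀ {S x y} → StackedDescents key S → key y < key x → All (λ z → key z < key y) S →
         StackedDescents key (S ++ x ∷ y ∷ [])

module _ {A : Set} (key : A → ℕ) where
  StackedDescents⇒pattern : ∀ {S} → StackedDescents key S → Σ ℕ λ m → length S ≡ 2 * m × st (map key S) ≡ pat21 m
  StackedDescents⇒pattern [] = 0 , refl , refl
  StackedDescents⇒pattern (snoc {S} {x} {y} d y<x S<y) with StackedDescents⇒pattern d
  ... | m , lS , stS = suc m , length-snoc , st-snoc′
    where
    w<y : All (_< key y) (map key S)
    w<y = AllP.map⁺ S<y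
    lw : length (map key S) ≡ 2 * m
    lw = trans (length-map key S) lS
    length-snoc : length (S ++ x ∷ y ∷ []) ≡ 2 * suc m
    length-snoc = trans (length-++ S) (trans (cong (_+ 2) lS) (trans (+-comm (2 * m) 2) (sym (*-suc 2 m))))
    st-snoc′ : st (map key (S ++ x ∷ y ∷ [])) ≡ pat21 (suc m)
    st-snoc′ rewrite map-++ key S (x ∷ y ∷ []) =
      trans (st-snoc (map key S) (key x) (key y))
        (cong₂ _++_ (trans (rank-below (map key S) (key x) (key y) y<x w<y) stS)
          (cong₂ _∷_ (trans (rank-top (map key S) (key x) (key y) y<x w<y) (cong (λ z → suc (suc z)) lw))
            (cong₂ _∷_ (trans (rank-second (map key S) (key x) (key y) y<x w<y) (cong suc lw)) refl)))

  pattern⇒StackedDescents : ∀ m S → length S ≡ 2 * m → st (map key S) ≡ pat21 m → StackedDescents key S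
  pattern⇒StackedDescents zero [] _ _ = []
  pattern⇒StackedDescents (suc m) S l e with split-last-two S (2 * m) (trans l (*-suc 2 m))
  ... | S′ , x , y , refl , l′ = snoc (pattern⇒StackedDescents m S′ l′ st′) y<x (AllP.map⁻ w<y)
    where
    w : List ℕ
    w = map key S′
    R : ℕ → ℕ
    R = rank (w ++ key x ∷ key y ∷ [])
    lw : length w ≡ 2 * m
    lw = trans (length-map key S′) l′
    split : map R w ≡ pat21 m × (R (key x) ∷ R (key y) ∷ []) ≡ (suc (suc (2 * m)) ∷ suc (2 * m) ∷ [])
    split = ++-injective (map R w) (pat21 m) (trans (length-map _ w) (trans lw (sym (length-pat21 m))))
              (trans (sym (st-snoc w (key x) (key y))) (trans (cong st (sym (map-++ key S′ (x ∷ y ∷ [])))) e))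
    top : key y < key x × All (_< key y) w
    top = top-pair-from-ranks w (key x) (key y) m lw (∷-injectiveˡ (proj₂ split)) (∷-injectiveˡ (∷-injectiveʳ (proj₂ split)))
    y<x : key y < key x
    y<x = proj₁ top
    w<y : All (_< key y) w
    w<y = proj₂ top
    st′ : st w ≡ pat21 m
    st′ = trans (sym (rank-below w (key x) (key y) y<x w<y)) (proj₁ split)

-- Inversions within a block of positions

AllPairs-++⁻ : {A : Set} {R : A → A → Set} (xs : List A) {ys : List A} → AllPairs R (xs ++ ys) →
  AllPairs R xs × AllPairs R ys × All (λ x → All (R x) ys) xs
AllPairs-++⁻ [] ap = [] , ap , []
AllPairs-++⁻ (x ∷ xs) (a ∷ ap) with AllPairs-++⁻ xs ap
... | p1 , p2 , p3 = (AllP.++⁻ˡ xs a ∷ p1) , p2 , (AllP.++⁻ʳ xs a ∷ p3)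

sorted-snoc⁻ : ∀ {n} (S : List (Fin n)) x y → Sorted (S ++ x ∷ y ∷ []) →
  Sorted S × toℕ x < toℕ y × (∀ z → z ∈ S → toℕ z < toℕ x × toℕ z < toℕ y)
sorted-snoc⁻ S x y s with AllPairs-++⁻ S s
... | sS , (x<y ∷ _) , S<xy = sS , AllM.lookup x<y (here refl) ,
      λ z z∈S → let z<xy = AllM.lookup S<xy z∈S in AllM.lookup z<xy (here refl) , AllM.lookup z<xy (there (here refl))

module InversionGraph {n : ℕ} (key : Fin n → ℕ) (key-injective : ∀ u v → key u ≡ key v → u ≡ v) where
  inv : Graph n
  inv u v = ((u <F v) ∧ (key v <ᵇ key u)) ∨ ((v <F u) ∧ (key u <ᵇ key v))

  inv-< : ∀ u v → toℕ u < toℕ v → inv u v ≡ (key v <ᵇ key u)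
  inv-< u v u<v rewrite <⇒<F {i = u} {v} u<v | ≮⇒<F≡false {i = v} {u} (<-asym u<v) with key v <ᵇ key u
  ... | true = refl
  ... | false = refl

  inv-> : ∀ u v → toℕ v < toℕ u → inv u v ≡ (key u <ᵇ key v)
  inv-> u v v<u rewrite <⇒<F {i = v} {u} v<u | ≮⇒<F≡false {i = u} {v} (<-asym v<u) = refl

  inv-irrefl : ∀ u → inv u u ≡ false
  inv-irrefl u rewrite ≮⇒<F≡false {i = u} {u} (<-irrefl refl) = refl

  inversions : Fin n → List (Fin n) → ℕ
  inversions u S = ∑ S (λ v → ⟦ inv u v ⟧)

  Matched : List (Fin n) → Set
  Matched S = ∀ u → u ∈ S → inversions u S ≡ 1

  inversions-snoc : ∀ u S x y → inversions u (S ++ x ∷ y ∷ []) ≡ inversions u S + (⟦ inv u x ⟧ + (⟦ inv u y ⟧ + 0))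
  inversions-snoc u S x y = ∑-++ S (x ∷ y ∷ []) _

  key-<-injective : ∀ u v → toℕ u < toℕ v → key u ≢ key v
  key-<-injective u v u<v e = <-irrefl (cong toℕ (key-injective u v e)) u<v

  inversions-with-top-pair : ∀ u x y → toℕ u < toℕ x → toℕ u < toℕ y → key u < key y → key y < key x →
    ⟦ inv u x ⟧ + (⟦ inv u y ⟧ + 0) ≡ 0
  inversions-with-top-pair u x y u<x u<y ku<ky ky<kx =
    cong₂ (λ p q → ⟦ p ⟧ + (⟦ q ⟧ + 0))
      (trans (inv-< u x u<x) (≮⇒<ᵇ-false (λ kx<ku → <-asym kx<ku (<-trans ku<ky ky<kx))))
      (trans (inv-< u y u<y) (≮⇒<ᵇ-false (<-asym ku<ky)))

  StackedDescents⇒Matched : ∀ {S} → StackedDescents key S → Sorted S → Matched S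
  StackedDescents⇒Matched [] _ u ()
  StackedDescents⇒Matched (snoc {S} {x} {y} d ky<kx S<y) s u u∈ with sorted-snoc⁻ S x y s
  ... | sS , x<y , S<xy with ∈-++⁻ S u∈
  ...   | inj₁ u∈S = trans (inversions-snoc u S x y)
            (trans (cong (inversions u S +_) (inversions-with-top-pair u x y (proj₁ (S<xy u u∈S)) (proj₂ (S<xy u u∈S)) (AllM.lookup S<y u∈S) ky<kx))
              (trans (+-identityʳ _) (StackedDescents⇒Matched d sS u u∈S)))
  ...   | inj₂ (here refl) = trans (inversions-snoc x S x y)
            (cong₂ _+_ none (cong₂ (λ p q → ⟦ p ⟧ + (⟦ q ⟧ + 0)) (inv-irrefl x) (trans (inv-< x y x<y) (<⇒<ᵇ-true ky<kx))))
    where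
    none : inversions x S ≡ 0
    none = ∑-zero-∈ S _ (λ z z∈S → cong ⟦_⟧ (trans (inv-> x z (proj₁ (S<xy z z∈S)))
             (≮⇒<ᵇ-false (λ kx<kz → <-asym kx<kz (<-trans (AllM.lookup S<y z∈S) ky<kx)))))
  ...   | inj₂ (there (here refl)) = trans (inversions-snoc y S x y)
            (cong₂ _+_ none (cong₂ (λ p q → ⟦ p ⟧ + (⟦ q ⟧ + 0)) (trans (inv-> y x x<y) (<⇒<ᵇ-true ky<kx)) (inv-irrefl y)))
    where
    none : inversions y S ≡ 0
    none = ∑-zero-∈ S _ (λ z z∈S → cong ⟦_⟧ (trans (inv-> y z (proj₂ (S<xy z z∈S)))
             (≮⇒<ᵇ-false (<-asym (AllM.lookup S<y z∈S)))))

  module LastPair (S : List (Fin n)) (x y : Fin n) (s : Sorted (S ++ x ∷ y ∷ [])) (matched : Matched (S ++ x ∷ y ∷ [])) where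
    private
      S<xy : ∀ z → z ∈ S → toℕ z < toℕ x × toℕ z < toℕ y
      S<xy = proj₂ (proj₂ (sorted-snoc⁻ S x y s))
      x<y : toℕ x < toℕ y
      x<y = proj₁ (proj₂ (sorted-snoc⁻ S x y s))
      y-count : inversions y S + (⟦ inv y x ⟧ + (⟦ inv y y ⟧ + 0)) ≡ 1
      y-count = trans (sym (inversions-snoc y S x y)) (matched y (∈-++⁺ʳ S (there (here refl))))

    -- Otherwise y's partner z lies in S above y, and then z inverts with both x and y.
    descent : key y < key x
    descent with <-cmp (key y) (key x)
    ... | tri< lt _ _ = lt
    ... | tri≈ _ eq _ = ⊥-elim (key-<-injective x y x<y (sym eq))
    ... | tri> _ _ kx<ky = ⊥-elim (<-irrefl refl (subst (1 <_) (matched z (∈-++⁺ˡ z∈S)) two≤))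
      where
      y-count-S : inversions y S ≡ 1
      y-count-S = trans (sym (trans (cong (λ q → inversions y S + (⟦ q ⟧ + (⟦ inv y y ⟧ + 0)))
                    (trans (inv-> y x x<y) (≮⇒<ᵇ-false (<-asym kx<ky))))
                    (trans (cong (λ q → inversions y S + (0 + (⟦ q ⟧ + 0))) (inv-irrefl y)) (+-identityʳ _)))) y-count
      partner : Σ (Fin n) λ z → z ∈ S × inv y z ≡ true
      partner = ∑≢0⇒∃ S (inv y) (λ e → 0≢1+n (trans (sym e) y-count-S))
      z : Fin n
      z = proj₁ partner
      z∈S : z ∈ S
      z∈S = proj₁ (proj₂ partner)
      ky<kz : key y < key z
      ky<kz = <ᵇ-true⇒< (trans (sym (inv-> y z (proj₂ (S<xy z z∈S)))) (proj₂ (proj₂ partner)))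
      two≤ : 1 < inversions z (S ++ x ∷ y ∷ [])
      two≤ = subst (1 <_) (sym (trans (inversions-snoc z S x y) (cong₂ (λ p q → inversions z S + (⟦ p ⟧ + (⟦ q ⟧ + 0)))
               (trans (inv-< z x (proj₁ (S<xy z z∈S))) (<⇒<ᵇ-true (<-trans kx<ky ky<kz)))
               (trans (inv-< z y (proj₂ (S<xy z z∈S))) (<⇒<ᵇ-true ky<kz)))))
               (subst (1 <_) (sym (+-comm (inversions z S) 2)) (s≤s (s≤s z≤n)))

    below : All (λ z → key z < key y) S
    below = AllM.tabulate λ {z} z∈S → below-y z z∈S
      where
      y-count-S : inversions y S ≡ 0
      y-count-S = ℕ-suc-injective (trans (+-comm 1 (inversions y S)) (trans (sym (cong₂ (λ p q → inversions y S + (⟦ p ⟧ + (⟦ q ⟧ + 0)))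
                    (trans (inv-> y x x<y) (<⇒<ᵇ-true descent)) (inv-irrefl y))) y-count))
      below-y : ∀ z → z ∈ S → key z < key y
      below-y z z∈S with <-cmp (key z) (key y)
      ... | tri< lt _ _ = lt
      ... | tri≈ _ eq _ = ⊥-elim (key-<-injective z y (proj₂ (S<xy z z∈S)) eq)
      ... | tri> _ _ ky<kz = ⊥-elim (true≢false (trans (sym (<⇒<ᵇ-true ky<kz))
                              (trans (sym (inv-> y z (proj₂ (S<xy z z∈S)))) (∑≡0⇒∀ S (inv y) y-count-S z z∈S))))

    matched-prefix : Matched S
    matched-prefix u u∈S = trans (sym (trans (cong (inversions u S +_)
                              (inversions-with-top-pair u x y (proj₁ (S<xy u u∈S)) (proj₂ (S<xy u u∈S)) (AllM.lookup below u∈S) descent))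
                              (+-identityʳ _)))
                            (trans (sym (inversions-snoc u S x y)) (matched u (∈-++⁺ˡ u∈S)))

    sorted-prefix : Sorted S
    sorted-prefix = proj₁ (sorted-snoc⁻ S x y s)

  Matched⇒StackedDescents : ∀ N S → length S ≡ N → Sorted S → Matched S → StackedDescents key S
  Matched⇒StackedDescents zero [] _ _ _ = []
  Matched⇒StackedDescents (suc zero) (y ∷ []) _ _ matched =
    ⊥-elim (0≢1+n (trans (sym (cong (λ q → ⟦ q ⟧ + 0) (inv-irrefl y))) (matched y (here refl))))
  Matched⇒StackedDescents (suc (suc m)) S l s matched with split-last-two S m l
  ... | S′ , x , y , refl , l′ = snoc (Matched⇒StackedDescents m S′ l′ sorted-prefix matched-prefix) descent below
    where open LastPair S′ x y s matched

module PatternBlocks {n : ℕ} (α : Permutation′ n) where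
  val-injective : ∀ u v → val α u ≡ val α v → u ≡ v
  val-injective u v e = trans (sym (inverseˡ α)) (trans (cong (α ⟨$⟩ˡ_) (toℕ-injective e)) (inverseˡ α))

  open InversionGraph (val α) val-injective public

  isPattern : List (Fin n) → Bool
  isPattern S = (length S % 2 ≡ᵇ 0) ∧ (st (map (val α) S) =L pat21 (length S / 2))

  isPattern⇒Matched : ∀ S → Sorted S → isPattern S ≡ true → Matched S
  isPattern⇒Matched S s h = StackedDescents⇒Matched (pattern⇒StackedDescents (val α) (length S / 2) S
    (sym (even⇒2*half _ (∧-elimˡ h))) (=L-true⇒≡ (∧-elimʳ {length S % 2 ≡ᵇ 0} h))) s

  Matched⇒isPattern : ∀ S → Sorted S → Matched S → isPattern S ≡ true
  Matched⇒isPattern S s matched with StackedDescents⇒pattern (val α) (Matched⇒StackedDescents (length S) S refl s matched)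
  ... | m , lS , stS = ∧-intro (proj₁ halves) (≡⇒=L-true (trans stS (cong pat21 (sym (proj₂ halves)))))
    where
    halves : ((length S % 2 ≡ᵇ 0) ≡ true) × length S / 2 ≡ m
    halves = ≡2*⇒even (length S) m lS

  block : {ℓ : ℕ} → (Fin n → Fin ℓ) → Fin ℓ → List (Fin n)
  block f i = filterᵇ (λ p → f p == i) (allFin n)

  block-sorted : ∀ {ℓ} (f : Fin n → Fin ℓ) i → Sorted (block f i)
  block-sorted f i = filterᵇ-sorted _ (allFin n) (allFin-sorted n)

  inversions-block : ∀ {ℓ} (f : Fin n → Fin ℓ) i u → inversions u (block f i) ≡ ∑ (allFin n) (λ v → ⟦ (f v == i) ∧ inv u v ⟧)
  inversions-block f i u = trans (∑-filter (allFin n) _ _) (∑-cong (allFin n) (λ v → sym (⟦∧⟧ (f v == i) _)))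

  blocks-Matched⇒isMatchingColouring : ∀ {ℓ} (f : Fin n → Fin ℓ) → (∀ i → Matched (block f i)) → isMatchingColouring inv f ≡ true
  blocks-Matched⇒isMatchingColouring f matched = isMatchingColouring⁺ inv f (λ u →
    trans (sym (inversions-block f (f u) u)) (matched (f u) u (∈-filterᵇ⁺ (λ p → f p == f u) (allFin n) (∈-allFin u) (==-refl (f u)))))

  isMatchingColouring⇒blocks-Matched : ∀ {ℓ} (f : Fin n → Fin ℓ) → isMatchingColouring inv f ≡ true → ∀ i → Matched (block f i)
  isMatchingColouring⇒blocks-Matched f h i u u∈ with ==⇒≡ (∈-filterᵇ⁻ (λ p → f p == i) (allFin n) u∈)
  ... | refl = trans (inversions-block f (f u) u) (isMatchingColouring⁻ inv f h u)

  -- The condition counted by c (comp ℓ a) α.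
  isPatternPartition : (ℓ : ℕ) → (Fin ℓ → ℕ) → (Fin n → Fin ℓ) → Bool
  isPatternPartition ℓ a f = all (λ i → (countᵇ (λ p → f p == i) (allFin n) ≡ᵇ a i)
                                      ∧ (a i % 2 ≡ᵇ 0)
                                      ∧ (st (restrict α f i) =L pat21 (a i / 2)))
                                 (allFin ℓ)

  isPatternPartition⁻ : ∀ ℓ a f → isPatternPartition ℓ a f ≡ true →
    (∀ i → ∑ (allFin n) (λ v → ⟦ f v == i ⟧) ≡ a i) × isMatchingColouring inv f ≡ true
  isPatternPartition⁻ ℓ a f h = sizes , blocks-Matched⇒isMatchingColouring f matched
    where
    size : ∀ i → countᵇ (λ p → f p == i) (allFin n) ≡ a i
    size i = ≡ᵇ-true⇒≡ (∧-elimˡ (all-allFin⁻ ℓ _ h i))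
    sizes : ∀ i → ∑ (allFin n) (λ v → ⟦ f v == i ⟧) ≡ a i
    sizes i = trans (sym (countᵇ≡∑ _ (allFin n))) (size i)
    matched : ∀ i → Matched (block f i)
    matched i = isPattern⇒Matched (block f i) (block-sorted f i)
      (subst (λ z → ((z % 2 ≡ᵇ 0) ∧ (st (map (val α) (block f i)) =L pat21 (z / 2))) ≡ true) (sym (size i))
        (∧-elimʳ {countᵇ (λ p → f p == i) (allFin n) ≡ᵇ a i} (all-allFin⁻ ℓ _ h i)))

  isPatternPartition⁺ : ∀ ℓ a f → (∀ i → ∑ (allFin n) (λ v → ⟦ f v == i ⟧) ≡ a i) → isMatchingColouring inv f ≡ true →
    isPatternPartition ℓ a f ≡ true
  isPatternPartition⁺ ℓ a f sizes colouring = all-allFin⁺ ℓ _ (λ i → ∧-intro (≡⇒≡ᵇ-true (size i))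
    (subst (λ z → ((z % 2 ≡ᵇ 0) ∧ (st (map (val α) (block f i)) =L pat21 (z / 2))) ≡ true) (size i)
      (Matched⇒isPattern (block f i) (block-sorted f i) (isMatchingColouring⇒blocks-Matched f colouring i))))
    where
    size : ∀ i → countᵇ (λ p → f p == i) (allFin n) ≡ a i
    size i = trans (countᵇ≡∑ _ (allFin n)) (sizes i)

-- The left-hand side counts matching colourings

if-then-0≡⟦⟧* : ∀ b x → (if b then x else 0) ≡ ⟦ b ⟧ * x
if-then-0≡⟦⟧* true x = sym (+-identityʳ x)
if-then-0≡⟦⟧* false x = refl

expo≡∑ : {ℓ k : ℕ} (ι : Fin ℓ → Fin k) (a : Fin ℓ → ℕ) (j : Fin k) → expo ι a j ≡ ∑ (allFin ℓ) (λ t → ⟦ ι t == j ⟧ * a t)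
expo≡∑ {ℓ} ι a j = trans (sum-map≡∑ _ (allFin ℓ)) (∑-cong (allFin ℓ) (λ t → if-then-0≡⟦⟧* (ι t == j) (a t)))

module PatternSide {n : ℕ} (α : Permutation′ n) (k : ℕ) (β : Fin k → ℕ) where
  open PatternBlocks α

  isComposition : (ℓ : ℕ) → (Fin ℓ → Fin (suc n)) → Bool
  isComposition ℓ A = all (λ t → 0 <ᵇ toℕ (A t)) (allFin ℓ) ∧ (sum (map (λ t → toℕ (A t)) (allFin ℓ)) ≡ᵇ n)

  partsOf : {ℓ : ℕ} → (Fin ℓ → Fin (suc n)) → Fin ℓ → ℕ
  partsOf A t = toℕ (A t)

  isMonomialOfType : (ℓ : ℕ) → (Fin ℓ → ℕ) → (Fin ℓ → Fin k) → Bool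
  isMonomialOfType ℓ a ι = strictlyIncr ι ∧ all (λ j → expo ι a j ≡ᵇ β j) (allFin k)

  -- A composition (encoded by its parts A), an ordered set partition f and a monomial ι of M_a.
  Witness : Set
  Witness = Σ ℕ (λ ℓ → (Fin ℓ → Fin (suc n)) × (Fin n → Fin ℓ) × (Fin ℓ → Fin k))

  withPartition : (ℓ : ℕ) → (Fin ℓ → Fin (suc n)) → (Fin n → Fin ℓ) → List Witness
  withPartition ℓ A f = map (λ ι → (ℓ , A , f , ι)) (funs ℓ k)

  withParts : (ℓ : ℕ) → (Fin ℓ → Fin (suc n)) → List Witness
  withParts ℓ A = concatMap (withPartition ℓ A) (funs n ℓ)

  ofLength : ℕ → List Witness
  ofLength ℓ = concatMap (withParts ℓ) (funs ℓ (suc n))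

  witnesses : List Witness
  witnesses = concatMap ofLength (upTo (suc n))

  ∑-witnesses : (F : Witness → ℕ) →
    ∑ witnesses F ≡ ∑ (upTo (suc n)) (λ ℓ → ∑ (funs ℓ (suc n)) (λ A → ∑ (funs n ℓ) (λ f → ∑ (funs ℓ k) (λ ι → F (ℓ , A , f , ι)))))
  ∑-witnesses F =
    trans (∑-concatMap ofLength (upTo (suc n)) F) (∑-cong (upTo (suc n)) (λ ℓ →
      trans (∑-concatMap (withParts ℓ) (funs ℓ (suc n)) F) (∑-cong (funs ℓ (suc n)) (λ A →
        trans (∑-concatMap (withPartition ℓ A) (funs n ℓ) F) (∑-cong (funs n ℓ) (λ f → ∑-map (λ ι → (ℓ , A , f , ι)) (funs ℓ k) F))))))

  counted : Witness → Bool
  counted (ℓ , A , f , ι) = isComposition ℓ A ∧ (isPatternPartition ℓ (partsOf A) f ∧ isMonomialOfType ℓ (partsOf A) ι)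

  composes : Witness → (Fin n → Fin k) → Bool
  composes (ℓ , A , f , ι) κ = (ι ∘ f) ≗ᵇ κ

  coefficient≡count : Ψ21 α k β ≡ ∑ witnesses (λ q → ⟦ counted q ⟧)
  coefficient≡count = begin
      Ψ21 α k β
        ≡⟨ ΣS-coefficient _ (compositions n) k β ⟩
      ∑ (compositions n) (λ a → c a α * M (Composition.parts a) k β)
        ≡⟨ ∑-concatMap compositionsOfLength (upTo (suc n)) _ ⟩
      ∑ (upTo (suc n)) (λ ℓ → ∑ (compositionsOfLength ℓ) (λ a → c a α * M (Composition.parts a) k β))
        ≡⟨ ∑-cong (upTo (suc n)) (λ ℓ → trans (∑-map (λ A → comp ℓ (partsOf A)) (filterᵇ (isComposition ℓ) (funs ℓ (suc n))) _)
             (trans (∑-filter (funs ℓ (suc n)) (isComposition ℓ) _) (∑-cong (funs ℓ (suc n)) (product ℓ)))) ⟩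
      ∑ (upTo (suc n)) (λ ℓ → ∑ (funs ℓ (suc n)) (λ A → ∑ (funs n ℓ) (λ f → ∑ (funs ℓ k) (λ ι → ⟦ counted (ℓ , A , f , ι) ⟧))))
        ≡⟨ sym (∑-witnesses _) ⟩
      ∑ witnesses (λ q → ⟦ counted q ⟧) ∎
    where
    open ≡-Reasoning
    compositionsOfLength : (ℓ : ℕ) → List (Composition n)
    compositionsOfLength ℓ = map (λ A → comp ℓ (partsOf A)) (filterᵇ (isComposition ℓ) (funs ℓ (suc n)))
    product : ∀ ℓ A → ⟦ isComposition ℓ A ⟧ * (c (comp ℓ (partsOf A)) α * M (partsOf A) k β)
                    ≡ ∑ (funs n ℓ) (λ f → ∑ (funs ℓ k) (λ ι → ⟦ counted (ℓ , A , f , ι) ⟧))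
    product ℓ A = trans (cong (⟦ isComposition ℓ A ⟧ *_) (cong₂ _*_ (countᵇ≡∑ _ (funs n ℓ)) (countᵇ≡∑ _ (funs ℓ k))))
                        (∑-product (isComposition ℓ A) (funs n ℓ) (funs ℓ k) (isPatternPartition ℓ (partsOf A)) (isMonomialOfType ℓ (partsOf A)))

  module Counted (ℓ : ℕ) (A : Fin ℓ → Fin (suc n)) (f : Fin n → Fin ℓ) (ι : Fin ℓ → Fin k) (h : counted (ℓ , A , f , ι) ≡ true) where
    a : Fin ℓ → ℕ
    a = partsOf A

    private
      composition : isComposition ℓ A ≡ true
      composition = ∧-elimˡ h
      partition : isPatternPartition ℓ a f ≡ true
      partition = ∧-elimˡ (∧-elimʳ {isComposition ℓ A} h)
      monomial : isMonomialOfType ℓ a ι ≡ true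
      monomial = ∧-elimʳ {isPatternPartition ℓ a f} (∧-elimʳ {isComposition ℓ A} h)

    block-sizes : ∀ t → ∑ (allFin n) (λ v → ⟦ f v == t ⟧) ≡ a t
    block-sizes = proj₁ (isPatternPartition⁻ ℓ a f partition)

    f-matching : isMatchingColouring inv f ≡ true
    f-matching = proj₂ (isPatternPartition⁻ ℓ a f partition)

    ι-increasing : Increasing ι
    ι-increasing = strictlyIncr⇒Increasing ι (∧-elimˡ monomial)

    ι-injective : ∀ s t → ι s ≡ ι t → s ≡ t
    ι-injective = Increasing⇒injective ι ι-increasing

    exponents : ∀ j → ∑ (allFin ℓ) (λ t → ⟦ ι t == j ⟧ * a t) ≡ β j
    exponents j = trans (sym (expo≡∑ ι a j)) (≡ᵇ-true⇒≡ (all-allFin⁻ k _ (∧-elimʳ {strictlyIncr ι} monomial) j))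

    parts-positive : ∀ t → 0 < a t
    parts-positive t = <ᵇ-true⇒< (all-allFin⁻ ℓ _ (∧-elimˡ composition) t)

    part≡β : ∀ t → a t ≡ β (ι t)
    part≡β t = trans (sym (trans (∑-cong (allFin ℓ) (λ s → cong (λ z → ⟦ z ⟧ * a s) (injective⇒==-reflected ι ι-injective s t)))
                                 (∑-δ ℓ t a)))
                     (exponents (ι t))

  unique-composite : ∀ q → counted q ≡ true → ∑ (funs n k) (λ κ → ⟦ composes q κ ⟧) ≡ 1
  unique-composite (ℓ , A , f , ι) _ = ∑-funs-≗ᵇ′ n k (ι ∘ f)

  composite-is-matching-colouring : ∀ q κ → counted q ≡ true → composes q κ ≡ true →
    (isMatchingColouring inv κ ∧ hasType κ β) ≡ true
  composite-is-matching-colouring (ℓ , A , f , ι) κ h r = ∧-intro matching type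
    where
    open Counted ℓ A f ι h
    ι∘f≡κ : ∀ v → ι (f v) ≡ κ v
    ι∘f≡κ = ≗ᵇ⇒≗ r
    matching : isMatchingColouring inv κ ≡ true
    matching = isMatchingColouring⁺ inv κ (λ u → trans (∑-cong (allFin n) (λ v → cong (λ z → ⟦ z ∧ inv u v ⟧)
                 (trans (cong₂ _==_ (sym (ι∘f≡κ v)) (sym (ι∘f≡κ u))) (injective⇒==-reflected ι ι-injective (f v) (f u)))))
                 (isMatchingColouring⁻ inv f f-matching u))
    type : hasType κ β ≡ true
    type = hasType⁺ κ β (λ j → trans (∑-cong (allFin n) (λ v → cong (λ z → ⟦ z == j ⟧) (sym (ι∘f≡κ v))))
             (trans (∑-fibres f (λ t → ⟦ ι t == j ⟧))
               (trans (∑-cong (allFin ℓ) (λ t → trans (cong (_* ⟦ ι t == j ⟧) (block-sizes t)) (*-comm (a t) _))) (exponents j))))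

  -- The unique witness over κ: ι₀ enumerates the colours used by κ, f₀ sends v to the position of κ v.
  module Preimage (κ : Fin n → Fin k) (κ-ok : (isMatchingColouring inv κ ∧ hasType κ β) ≡ true) where
    private
      one-partner : ∀ u → ∑ (allFin n) (λ v → ⟦ (κ v == κ u) ∧ inv u v ⟧) ≡ 1
      one-partner = isMatchingColouring⁻ inv κ (∧-elimˡ κ-ok)
      type : ∀ j → ∑ (allFin n) (λ v → ⟦ κ v == j ⟧) ≡ β j
      type = hasType⁻ κ β (∧-elimʳ {isMatchingColouring inv κ} κ-ok)

    used : Fin k → Bool
    used j = 0 <ᵇ β j

    open Enumeration used public
      using () renaming (elems to support; elem to ι₀; elem-satisfies to ι₀-used; index to support-index;
                         elem-increasing to ι₀-increasing; elem-injective to ι₀-injective)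

    ℓ₀ : ℕ
    ℓ₀ = length support

    κ-used : ∀ v → used (κ v) ≡ true
    κ-used v = <⇒<ᵇ-true (≤-trans (≤-reflexive (cong ⟦_⟧ (sym (==-refl (κ v)))))
                 (subst (⟦ κ v == κ v ⟧ ≤_) (type (κ v)) (∑-allFin-≥ n (λ w → ⟦ κ w == κ v ⟧) v)))

    f₀ : Fin n → Fin ℓ₀
    f₀ v = proj₁ (support-index (κ v) (κ-used v))

    ι₀∘f₀≡κ : ∀ v → ι₀ (f₀ v) ≡ κ v
    ι₀∘f₀≡κ v = proj₂ (support-index (κ v) (κ-used v))

    a₀ : Fin ℓ₀ → ℕ
    a₀ t = β (ι₀ t)

    a₀≤n : ∀ t → a₀ t ≤ n
    a₀≤n t = subst (_≤ n) (type (ι₀ t))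
               (subst (∑ (allFin n) (λ v → ⟦ κ v == ι₀ t ⟧) ≤_) (∑-allFin-const-1 n) (∑-mono-≤ (allFin n) _ _ (λ v → ⟦⟧≤1 _)))

    A₀ : Fin ℓ₀ → Fin (suc n)
    A₀ t = fromℕ< (s≤s (a₀≤n t))

    f₀-sizes : ∀ t → ∑ (allFin n) (λ v → ⟦ f₀ v == t ⟧) ≡ a₀ t
    f₀-sizes t = trans (∑-cong (allFin n) (λ v → cong ⟦_⟧ (trans (sym (injective⇒==-reflected ι₀ ι₀-injective (f₀ v) t))
                                                                    (cong (_== ι₀ t) (ι₀∘f₀≡κ v)))))
                       (type (ι₀ t))

    ∑a₀≡n : ∑ (allFin ℓ₀) a₀ ≡ n
    ∑a₀≡n = begin
        ∑ (allFin ℓ₀) a₀                                      ≡⟨ sym (∑-cong (allFin ℓ₀) f₀-sizes) ⟩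
        ∑ (allFin ℓ₀) (λ t → ∑ (allFin n) (λ v → ⟦ f₀ v == t ⟧)) ≡⟨ ∑-swap (allFin ℓ₀) (allFin n) _ ⟩
        ∑ (allFin n) (λ v → ∑ (allFin ℓ₀) (λ t → ⟦ f₀ v == t ⟧)) ≡⟨ ∑-cong (allFin n) (λ v →
                                                                 trans (∑-cong (allFin ℓ₀) (λ t → cong ⟦_⟧ (==-sym (f₀ v) t))) (∑-δ₁ ℓ₀ (f₀ v))) ⟩
        ∑ (allFin n) (λ _ → 1)                                ≡⟨ ∑-allFin-const-1 n ⟩
        n                                                     ∎
      where open ≡-Reasoning

    ℓ₀≤n : ℓ₀ ≤ n
    ℓ₀≤n = subst₂ _≤_ (∑-allFin-const-1 ℓ₀) ∑a₀≡n (∑-mono-≤ (allFin ℓ₀) _ _ (λ t → <ᵇ-true⇒< (ι₀-used t)))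

    exponents₀ : ∀ j → ∑ (allFin ℓ₀) (λ t → ⟦ ι₀ t == j ⟧ * a₀ t) ≡ β j
    exponents₀ j = trans (∑-cong (allFin ℓ₀) at) (trans (∑-*ʳ (allFin ℓ₀) (β j) _) by-usage)
      where
      at : ∀ t → ⟦ ι₀ t == j ⟧ * a₀ t ≡ ⟦ ι₀ t == j ⟧ * β j
      at t with ι₀ t == j in q
      ... | false = refl
      ... | true = cong (λ z → 1 * β z) (==⇒≡ q)
      by-usage : ∑ (allFin ℓ₀) (λ t → ⟦ ι₀ t == j ⟧) * β j ≡ β j
      by-usage with used j in q
      ... | false = trans (cong (∑ (allFin ℓ₀) (λ t → ⟦ ι₀ t == j ⟧) *_) (unused⇒0 q)) (trans (*-zeroʳ (∑ (allFin ℓ₀) (λ t → ⟦ ι₀ t == j ⟧))) (sym (unused⇒0 q)))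
        where
        unused⇒0 : used j ≡ false → β j ≡ 0
        unused⇒0 u with β j
        ... | zero = refl
        unused⇒0 () | suc _
      ... | true = trans (cong (_* β j) (trans (∑-cong (allFin ℓ₀) (λ t → cong ⟦_⟧
                     (trans (cong (ι₀ t ==_) (sym (proj₂ (support-index j q)))) (injective⇒==-reflected ι₀ ι₀-injective t _))))
                     (∑-δ₁ ℓ₀ _))) (+-identityʳ (β j))

    f₀-matching : ∀ u → ∑ (allFin n) (λ v → ⟦ (f₀ v == f₀ u) ∧ inv u v ⟧) ≡ 1
    f₀-matching u = trans (∑-cong (allFin n) (λ v → cong (λ z → ⟦ z ∧ inv u v ⟧)
                      (trans (sym (injective⇒==-reflected ι₀ ι₀-injective (f₀ v) (f₀ u))) (cong₂ _==_ (ι₀∘f₀≡κ v) (ι₀∘f₀≡κ u)))))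
                      (one-partner u)

    module Over (ℓ : ℕ) (A : Fin ℓ → Fin (suc n)) (f : Fin n → Fin ℓ) (ι : Fin ℓ → Fin k)
                (h : counted (ℓ , A , f , ι) ≡ true) (r : composes (ℓ , A , f , ι) κ ≡ true) where
      open Counted ℓ A f ι h public

      ι∘f≡κ : ∀ v → ι (f v) ≡ κ v
      ι∘f≡κ = ≗ᵇ⇒≗ r

      ι-used : ∀ t → used (ι t) ≡ true
      ι-used t = <⇒<ᵇ-true (subst (0 <_) (part≡β t) (parts-positive t))

      ι-fibre : ∀ j → ∑ (allFin ℓ) (λ t → ⟦ ι t == j ⟧) ≡ ⟦ used j ⟧
      ι-fibre j with used j in q
      ... | false = ∑-zero (allFin ℓ) _ missed
        where
        missed : ∀ t → ⟦ ι t == j ⟧ ≡ 0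
        missed t = ¬true⇒⟦⟧≡0 (λ e → true≢false (trans (sym (ι-used t)) (trans (cong used (==⇒≡ e)) q)))
      ... | true = trans (∑-cong (allFin ℓ) (λ t → cong ⟦_⟧ (trans (cong (ι t ==_) (sym (==⇒≡ (proj₂ hit))))
                                                                  (injective⇒==-reflected ι ι-injective t (proj₁ hit)))))
                         (∑-δ₁ ℓ (proj₁ hit))
        where
        hit : Σ (Fin ℓ) λ t → (ι t == j) ≡ true
        hit = ∑-*≢0⇒∃ (allFin ℓ) (λ t → ι t == j) a (λ e → <-irrefl (sym (trans (sym (exponents j)) e)) (<ᵇ-true⇒< q))

      ℓ≡ℓ₀ : ℓ ≡ ℓ₀
      ℓ≡ℓ₀ = begin
          ℓ                                                        ≡⟨ sym (∑-allFin-const-1 ℓ) ⟩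
          ∑ (allFin ℓ) (λ _ → 1)                                   ≡⟨ sym (∑-cong (allFin ℓ) (λ t →
                                                                      trans (∑-cong (allFin k) (λ j → cong ⟦_⟧ (==-sym (ι t) j))) (∑-δ₁ k (ι t)))) ⟩
          ∑ (allFin ℓ) (λ t → ∑ (allFin k) (λ j → ⟦ ι t == j ⟧)) ≡⟨ ∑-swap (allFin ℓ) (allFin k) _ ⟩
          ∑ (allFin k) (λ j → ∑ (allFin ℓ) (λ t → ⟦ ι t == j ⟧)) ≡⟨ ∑-cong (allFin k) ι-fibre ⟩
          ∑ (allFin k) (λ j → ⟦ used j ⟧)                          ≡⟨ sym (countᵇ≡∑ used (allFin k)) ⟩
          ℓ₀                                                       ∎
        where open ≡-Reasoning

    module Over₀ (A : Fin ℓ₀ → Fin (suc n)) (f : Fin n → Fin ℓ₀) (ι : Fin ℓ₀ → Fin k)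
                 (h : counted (ℓ₀ , A , f , ι) ≡ true) (r : composes (ℓ₀ , A , f , ι) κ ≡ true) where
      open Over ℓ₀ A f ι h r

      ι≗ι₀ : ∀ t → ι t ≡ ι₀ t
      ι≗ι₀ = Increasing-same-image⇒≗ ι ι₀ ι-increasing ι₀-increasing ι⊆ι₀ ι₀⊆ι
        where
        ι⊆ι₀ : ∀ t → Σ (Fin ℓ₀) λ s → ι t ≡ ι₀ s
        ι⊆ι₀ t = proj₁ (support-index (ι t) (ι-used t)) , sym (proj₂ (support-index (ι t) (ι-used t)))
        ι₀⊆ι : ∀ s → Σ (Fin ℓ₀) λ t → ι₀ s ≡ ι t
        ι₀⊆ι s with ∑≢0⇒∃ (allFin ℓ₀) (λ t → ι t == ι₀ s)
                      (λ e → 0≢1+n (trans (sym e) (trans (ι-fibre (ι₀ s)) (cong ⟦_⟧ (ι₀-used s)))))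
        ... | t , _ , ιt≡ι₀s = t , sym (==⇒≡ ιt≡ι₀s)

      f≗f₀ : ∀ v → f v ≡ f₀ v
      f≗f₀ v = ι₀-injective (f v) (f₀ v) (trans (sym (ι≗ι₀ (f v))) (trans (ι∘f≡κ v) (sym (ι₀∘f₀≡κ v))))

      A≗A₀ : ∀ t → A t ≡ A₀ t
      A≗A₀ t = toℕ-injective (trans (part≡β t) (trans (cong β (ι≗ι₀ t)) (sym (toℕ-fromℕ< (s≤s (a₀≤n t))))))

    canonical-counted : ∀ A f ι → (∀ t → A t ≡ A₀ t) → (∀ v → f v ≡ f₀ v) → (∀ t → ι t ≡ ι₀ t) →
      (counted (ℓ₀ , A , f , ι) ∧ composes (ℓ₀ , A , f , ι) κ) ≡ true
    canonical-counted A f ι A≗ f≗ ι≗ = ∧-intro (∧-intro composition (∧-intro partition monomial))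
                                                (≗⇒≗ᵇ (λ v → trans (ι≗ (f v)) (trans (cong ι₀ (f≗ v)) (ι₀∘f₀≡κ v))))
      where
      parts≡ : ∀ t → partsOf A t ≡ a₀ t
      parts≡ t = trans (cong toℕ (A≗ t)) (toℕ-fromℕ< (s≤s (a₀≤n t)))
      composition : isComposition ℓ₀ A ≡ true
      composition = ∧-intro (all-allFin⁺ ℓ₀ _ (λ t → <⇒<ᵇ-true (subst (0 <_) (sym (parts≡ t)) (<ᵇ-true⇒< (ι₀-used t)))))
                            (≡⇒≡ᵇ-true (trans (sum-map≡∑ (partsOf A) (allFin ℓ₀)) (trans (∑-cong (allFin ℓ₀) parts≡) ∑a₀≡n)))
      partition : isPatternPartition ℓ₀ (partsOf A) f ≡ true
      partition = isPatternPartition⁺ ℓ₀ (partsOf A) f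
        (λ t → trans (∑-cong (allFin n) (λ v → cong (λ z → ⟦ z == t ⟧) (f≗ v))) (trans (f₀-sizes t) (sym (parts≡ t))))
        (isMatchingColouring⁺ inv f (λ u → trans (∑-cong (allFin n) (λ v → cong (λ z → ⟦ z ∧ inv u v ⟧) (cong₂ _==_ (f≗ v) (f≗ u))))
                                               (f₀-matching u)))
      monomial : isMonomialOfType ℓ₀ (partsOf A) ι ≡ true
      monomial = ∧-intro (Increasing⇒strictlyIncr ι (λ s t lt → subst₂ (λ p q → toℕ p < toℕ q) (sym (ι≗ s)) (sym (ι≗ t)) (ι₀-increasing s t lt)))
                         (all-allFin⁺ k _ (λ j → ≡⇒≡ᵇ-true (trans (expo≡∑ ι (partsOf A) j)
                           (trans (∑-cong (allFin ℓ₀) (λ t → cong₂ (λ p q → ⟦ p == j ⟧ * q) (ι≗ t) (parts≡ t))) (exponents₀ j)))))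

    counted-over≡canonical : ∀ A f ι → (counted (ℓ₀ , A , f , ι) ∧ composes (ℓ₀ , A , f , ι) κ) ≡ ((A ≗ᵇ A₀) ∧ ((f ≗ᵇ f₀) ∧ (ι ≗ᵇ ι₀)))
    counted-over≡canonical A f ι = bool-ext to from
      where
      to : (counted (ℓ₀ , A , f , ι) ∧ composes (ℓ₀ , A , f , ι) κ) ≡ true → ((A ≗ᵇ A₀) ∧ ((f ≗ᵇ f₀) ∧ (ι ≗ᵇ ι₀))) ≡ true
      to e = ∧-intro (≗⇒≗ᵇ A≗A₀) (∧-intro (≗⇒≗ᵇ f≗f₀) (≗⇒≗ᵇ ι≗ι₀))
        where open Over₀ A f ι (∧-elimˡ e) (∧-elimʳ {counted (ℓ₀ , A , f , ι)} e)
      from : ((A ≗ᵇ A₀) ∧ ((f ≗ᵇ f₀) ∧ (ι ≗ᵇ ι₀))) ≡ true → (counted (ℓ₀ , A , f , ι) ∧ composes (ℓ₀ , A , f , ι) κ) ≡ true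
      from e = canonical-counted A f ι (≗ᵇ⇒≗ (∧-elimˡ e)) (≗ᵇ⇒≗ (∧-elimˡ (∧-elimʳ {A ≗ᵇ A₀} e)))
                                       (≗ᵇ⇒≗ (∧-elimʳ {f ≗ᵇ f₀} (∧-elimʳ {A ≗ᵇ A₀} e)))

    countOfLength : ℕ → ℕ
    countOfLength ℓ = ∑ (funs ℓ (suc n)) (λ A → ∑ (funs n ℓ) (λ f → ∑ (funs ℓ k) (λ ι → ⟦ counted (ℓ , A , f , ι) ∧ composes (ℓ , A , f , ι) κ ⟧)))

    countOfLength-ℓ₀ : countOfLength ℓ₀ ≡ 1
    countOfLength-ℓ₀ = begin
        countOfLength ℓ₀
          ≡⟨ ∑-cong (funs ℓ₀ (suc n)) (λ A → ∑-cong (funs n ℓ₀) (λ f → ∑-cong (funs ℓ₀ k) (λ ι →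
               trans (cong ⟦_⟧ (counted-over≡canonical A f ι)) (trans (⟦∧⟧ (A ≗ᵇ A₀) _) (cong (⟦ A ≗ᵇ A₀ ⟧ *_) (⟦∧⟧ (f ≗ᵇ f₀) _)))))) ⟩
        ∑ (funs ℓ₀ (suc n)) (λ A → ∑ (funs n ℓ₀) (λ f → ∑ (funs ℓ₀ k) (λ ι → ⟦ A ≗ᵇ A₀ ⟧ * (⟦ f ≗ᵇ f₀ ⟧ * ⟦ ι ≗ᵇ ι₀ ⟧))))
          ≡⟨ ∑-cong (funs ℓ₀ (suc n)) (λ A → ∑-cong (funs n ℓ₀) (λ f → trans (∑-*ˡ (funs ℓ₀ k) ⟦ A ≗ᵇ A₀ ⟧ _)
               (cong (⟦ A ≗ᵇ A₀ ⟧ *_) (trans (∑-*ˡ (funs ℓ₀ k) ⟦ f ≗ᵇ f₀ ⟧ _) (cong (⟦ f ≗ᵇ f₀ ⟧ *_) (∑-funs-≗ᵇ ℓ₀ k ι₀)))))) ⟩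
        ∑ (funs ℓ₀ (suc n)) (λ A → ∑ (funs n ℓ₀) (λ f → ⟦ A ≗ᵇ A₀ ⟧ * (⟦ f ≗ᵇ f₀ ⟧ * 1)))
          ≡⟨ ∑-cong (funs ℓ₀ (suc n)) (λ A → trans (∑-*ˡ (funs n ℓ₀) ⟦ A ≗ᵇ A₀ ⟧ _)
               (cong (⟦ A ≗ᵇ A₀ ⟧ *_) (trans (∑-cong (funs n ℓ₀) (λ f → *-identityʳ ⟦ f ≗ᵇ f₀ ⟧)) (∑-funs-≗ᵇ n ℓ₀ f₀)))) ⟩
        ∑ (funs ℓ₀ (suc n)) (λ A → ⟦ A ≗ᵇ A₀ ⟧ * 1)
          ≡⟨ trans (∑-cong (funs ℓ₀ (suc n)) (λ A → *-identityʳ ⟦ A ≗ᵇ A₀ ⟧)) (∑-funs-≗ᵇ ℓ₀ (suc n) A₀) ⟩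
        1 ∎
      where open ≡-Reasoning

    countOfLength≡δ : ∀ ℓ → countOfLength ℓ ≡ ⟦ ℓ ≡ᵇ ℓ₀ ⟧
    countOfLength≡δ ℓ with ℓ ≟ℕ ℓ₀
    ... | yes refl = trans countOfLength-ℓ₀ (cong ⟦_⟧ (sym (≡⇒≡ᵇ-true {ℓ₀} refl)))
    ... | no ℓ≢ℓ₀ = trans (∑-zero (funs ℓ (suc n)) _ (λ A → ∑-zero (funs n ℓ) _ (λ f → ∑-zero (funs ℓ k) _ (λ ι →
                      ¬true⇒⟦⟧≡0 (λ e → ℓ≢ℓ₀ (Over.ℓ≡ℓ₀ ℓ A f ι (∧-elimˡ e) (∧-elimʳ {counted (ℓ , A , f , ι)} e)))))))
                      (sym (cong ⟦_⟧ (¬true⇒false (λ e → ℓ≢ℓ₀ (≡ᵇ-true⇒≡ e)))))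

  unique-preimage : ∀ κ → (isMatchingColouring inv κ ∧ hasType κ β) ≡ true → ∑ witnesses (λ q → ⟦ counted q ∧ composes q κ ⟧) ≡ 1
  unique-preimage κ κ-ok = trans (∑-witnesses _) (trans (∑-cong (upTo (suc n)) countOfLength≡δ) (∑-upTo-δ (suc n) ℓ₀ (s≤s ℓ₀≤n)))
    where open Preimage κ κ-ok

  Ψ21≡matchingColourings : Ψ21 α k β ≡ matchingColourings inv k β
  Ψ21≡matchingColourings = trans coefficient≡count
    (double-counting witnesses (funs n k) counted (λ κ → isMatchingColouring inv κ ∧ hasType κ β) composes
      unique-composite unique-preimage composite-is-matching-colouring)

proposition2p1 : (n : ℕ) → 2 ∣ n → (α : Permutation′ n) →
    Ψ21 α ≈S ΣS (map (λ μ → sq (X (contract (gα α) μ))) (perfectMatchings (gα α)))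
proposition2p1 n _ α k β =
  trans (PatternSide.Ψ21≡matchingColourings α k β)
        (sym (ContractionSide.contraction-sum≡matchingColourings (gα α) gα-sym (PatternBlocks.inv-irrefl α) k β))
  where
  gα-sym : ∀ u v → gα α u v ≡ gα α v u
  gα-sym u v = ∨-comm ((u <F v) ∧ (val α v <ᵇ val α u)) ((v <F u) ∧ (val α u <ᵇ val α v))
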